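{- Let $L_1,L_2$ be languages (with $L_2$ a language of pairs of strings), and suppose $L_1$ is $\mathsf{NP}$-hard. If $L_1$ split-hide reduces to $L_2$ and $L_2$ has an efficient BSM protocol, then every language in $\mathsf{NP}$ has an efficient instance hiding scheme with a single nonadaptive pair of queries.
   Context: $\mathsf{NP}$-hardness is with respect to polynomial-time reductions that map all instances of a given length $n$ to instances of a common length $m(n)$. A split-hide reduction from $L_1$ to $L_2$ is a pair of polynomial-time computable randomized mappings $a,b\colon\{0,1\}^n\to\{0,1\}^{\mathrm{poly}(n)}$ (using common randomness) such that for every choice of randomness $x\in L_1$ iff $(a(x),b(x))\in L_2$, and the marginal distributions of $a(x)$ and of $b(x)$ each depend only on $|x|$. A BSM protocol for $L_2$: arbitrary functions $A$ (Alice), $B$ (Bob) and Boolean circuits $C$ (Carol), one per input size, with $C(A(u),B(v))=1$ iff $(u,v)\in L_2$; efficient if Carol's size is polynomial in the input size. A two-query instance hiding scheme for a language $L$: a randomized circuit family (Henry) that on input $z\in\{0,1\}^n$ and randomness $r$ makes one query to each of two oracles (arbitrary functions), nonadaptively, and outputs whether $z\in L$ correctly for every $r$, such that each query's distribution separately depends only on $n$; efficient if Henry's size is polynomial in $n$. -}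

module Defs where

open import Data.Nat using (ℕ; zero; suc; _+_; _*_; _^_; _≤_)
open import Data.Bool using (Bool; true; false; _∧_; _∨_; not; if_then_else_)
open import Data.List using (List; []; _∷_; _++_; length)
open import Data.Vec as V using (Vec)
open import Data.Fin using (Fin; zero; suc)
open import Data.Maybe using (Maybe; just; nothing)
open import Data.Product using (Σ; ∃; ∃-syntax; _×_; _,_)
open import Relation.Binary.PropositionalEquality using (_≡_)

Lang : Set
Lang = List Bool → Bool

Lang₂ : Set
Lang₂ = List Bool → List Bool → Bool

PolyBounded : (ℕ → ℕ) → Set
PolyBounded f = ∃[ k ] (∀ n → f n ≤ k * n ^ k + k)

-- Counting over uniform randomness: number of r ∈ {0,1}^m with P r = true

countWhere : (m : ℕ) → (Vec Bool m → Bool) → ℕ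
countWhere zero    P = if P V.[] then 1 else 0
countWhere (suc m) P = countWhere m (λ r → P (false V.∷ r)) + countWhere m (λ r → P (true V.∷ r))

eqBit : Bool → Bool → Bool
eqBit true  true  = true
eqBit false false = true
eqBit _     _     = false

eqBits : ∀ {n} → Vec Bool n → Vec Bool n → Bool
eqBits V.[]       V.[]       = true
eqBits (a V.∷ as) (b V.∷ bs) = eqBit a b ∧ eqBits as bs

-- Machine model for polynomial time: deterministic single-tape Turing
-- machines over the tape alphabet {blank, 0, 1, #}.

Sym : Set
Sym = Fin 4

blank sym0 sym1 sep : Sym
blank = zero
sym0  = suc zero
sym1  = suc (suc zero)
sep   = suc (suc (suc zero))

encBit : Bool → Sym
encBit false = sym0
encBit true  = sym1

encode : List Bool → List Sym
encode []       = []
encode (b ∷ bs) = encBit b ∷ encode bs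

encode₂ : List Bool → List Bool → List Sym
encode₂ x y = encode x ++ (sep ∷ encode y)

decSym : Sym → Maybe Bool
decSym zero                   = nothing
decSym (suc zero)             = just false
decSym (suc (suc zero))       = just true
decSym (suc (suc (suc zero))) = nothing

data Move : Set where
  left right stay : Move

-- states are Fin (suc Q); the start state is zero
record TM : Set where
  field
    Q       : ℕ
    halting : Fin (suc Q) → Bool
    δ       : Fin (suc Q) → Sym → Fin (suc Q) × Sym × Move

record Config (M : TM) : Set where
  constructor config
  field
    state : Fin (suc (TM.Q M))
    lefts : List Sym      -- cells left of the head, nearest first
    head  : Sym
    rights : List Sym     -- cells right of the head, nearest first

initConfig : (M : TM) → List Sym → Config M
initConfig M []       = config zero [] blank []
initConfig M (c ∷ cs) = config zero [] c cs

moveHead : ∀ {M} → Fin (suc (TM.Q M)) → List Sym → Sym → List Sym → Move → Config M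
moveHead q []       w rs left  = config q [] blank (w ∷ rs)
moveHead q (l ∷ ls) w rs left  = config q ls l (w ∷ rs)
moveHead q ls       w []       right = config q (w ∷ ls) blank []
moveHead q ls       w (r ∷ rs) right = config q (w ∷ ls) r rs
moveHead q ls       w rs       stay  = config q ls w rs

step : (M : TM) → Config M → Config M
step M (config q ls h rs) with TM.halting M q
... | true  = config q ls h rs
... | false with TM.δ M q h
...   | (q' , w , mv) = moveHead {M} q' ls w rs mv

run : (M : TM) → ℕ → Config M → Config M
run M zero    c = c
run M (suc t) c = run M t (step M c)

-- output: the maximal string of bit symbols starting at the head
readBits : Sym → List Sym → List Bool
readBits h rs with decSym h
... | nothing = []
... | just b with rs
...   | []       = b ∷ []
...   | (r ∷ rs') = b ∷ readBits r rs'

output : ∀ {M} → Config M → List Bool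
output (config _ _ h rs) = readBits h rs

ComputesWithin : (M : TM) → ℕ → List Sym → List Bool → Set
ComputesWithin M T inp out =
  ∃[ t ] (t ≤ T × TM.halting M (Config.state (run M t (initConfig M inp))) ≡ true
                × output (run M t (initConfig M inp)) ≡ out)

PolyTimeFn : (List Bool → List Bool) → Set
PolyTimeFn f = ∃[ M ] ∃[ p ] (PolyBounded p × (∀ x → ComputesWithin M (p (length x)) (encode x) (f x)))

InNP : Lang → Set
InNP L =
  Σ (List Bool → List Bool → Bool) λ V → ∃[ M ] ∃[ p ] ∃[ q ]
    ( PolyBounded p × PolyBounded q
    × (∀ x w → ComputesWithin M (p (length x + length w)) (encode₂ x w) (V x w ∷ []))
    × (∀ x → (L x ≡ true → ∃[ w ] (length w ≤ q (length x) × V x w ≡ true))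
           × (∀ w → length w ≤ q (length x) → V x w ≡ true → L x ≡ true)))

-- NP-hardness under polynomial-time length-regular many-one reductions
NPHard : Lang → Set
NPHard L₁ =
  ∀ L → InNP L →
    Σ (List Bool → List Bool) λ f → Σ (ℕ → ℕ) λ m → (PolyTimeFn f × (∀ x → length (f x) ≡ m (length x)) × (∀ x → L x ≡ L₁ (f x)))

record SplitHide (L₁ : Lang) (L₂ : Lang₂) : Set where
  field
    ρ ℓa ℓb : ℕ → ℕ
    ρ-poly : PolyBounded ρ
    a : ∀ n → Vec Bool n → Vec Bool (ρ n) → Vec Bool (ℓa n)
    b : ∀ n → Vec Bool n → Vec Bool (ρ n) → Vec Bool (ℓb n)
    a-poly : ∃[ M ] ∃[ p ] (PolyBounded p ×
               (∀ n x r → ComputesWithin M (p n) (encode₂ (V.toList x) (V.toList r)) (V.toList (a n x r))))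
    b-poly : ∃[ M ] ∃[ p ] (PolyBounded p ×
               (∀ n x r → ComputesWithin M (p n) (encode₂ (V.toList x) (V.toList r)) (V.toList (b n x r))))
    correct : ∀ n x r → L₁ (V.toList x) ≡ L₂ (V.toList (a n x r)) (V.toList (b n x r))
    a-hide : ∀ n (x x' : Vec Bool n) (y : Vec Bool (ℓa n)) →
               countWhere (ρ n) (λ r → eqBits (a n x r) y) ≡ countWhere (ρ n) (λ r → eqBits (a n x' r) y)
    b-hide : ∀ n (x x' : Vec Bool n) (y : Vec Bool (ℓb n)) →
               countWhere (ρ n) (λ r → eqBits (b n x r) y) ≡ countWhere (ρ n) (λ r → eqBits (b n x' r) y)

-- Boolean circuits (fan-in ≤ 2, basis AND/OR/NOT) as straight-line programs.
-- Wires are numbered newest-first: a gate added after g gates on i inputs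
-- may read any of the g + i existing wires.

data Gate (k : ℕ) : Set where
  andG orG : Fin k → Fin k → Gate k
  notG     : Fin k → Gate k

data Gates (i : ℕ) : ℕ → Set where
  []  : Gates i 0
  _▷_ : ∀ {g} → Gates i g → Gate (g + i) → Gates i (suc g)

evalGate : ∀ {k} → Gate k → Vec Bool k → Bool
evalGate (andG u v) w = V.lookup w u ∧ V.lookup w v
evalGate (orG u v)  w = V.lookup w u ∨ V.lookup w v
evalGate (notG u)   w = not (V.lookup w u)

wires : ∀ {i g} → Gates i g → Vec Bool i → Vec Bool (g + i)
wires []        x = x
wires (gs ▷ gt) x = evalGate gt (wires gs x) V.∷ wires gs x

record Circuit (i o : ℕ) : Set where
  constructor circuit
  field
    g     : ℕ
    gates : Gates i g
    outs  : Vec (Fin (g + i)) o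

evalC : ∀ {i o} → Circuit i o → Vec Bool i → Vec Bool o
evalC (circuit g gs os) x = V.map (V.lookup (wires gs x)) os

size : ∀ {i o} → Circuit i o → ℕ
size {i} (circuit g _ _) = i + g

-- Efficient BSM protocols (Alice, Bob arbitrary; Carol a circuit),
-- one per input size (n₁, n₂) = (|u|, |v|).

record EfficientBSM (L₂ : Lang₂) : Set where
  field
    ℓA ℓB : ℕ → ℕ → ℕ
    A : ∀ n₁ n₂ → Vec Bool n₁ → Vec Bool (ℓA n₁ n₂)
    B : ∀ n₁ n₂ → Vec Bool n₂ → Vec Bool (ℓB n₁ n₂)
    C : ∀ n₁ n₂ → Circuit (ℓA n₁ n₂ + ℓB n₁ n₂) 1
    correct : ∀ n₁ n₂ (u : Vec Bool n₁) (v : Vec Bool n₂) →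
                evalC (C n₁ n₂) (A n₁ n₂ u V.++ B n₁ n₂ v) ≡ L₂ (V.toList u) (V.toList v) V.∷ V.[]
    efficient : ∃[ p ] (PolyBounded p × (∀ n₁ n₂ → size (C n₁ n₂) ≤ p (n₁ + n₂)))

-- Henry on input size n with randomness r ∈ {0,1}^(ρ n): query circuits
-- Q₁, Q₂ compute the two queries from (z, r); the decision circuit D reads
-- (z, r) and the two oracle answers.

record EfficientIH2 (L : Lang) : Set where
  field
    ρ m₁ m₂ k₁ k₂ : ℕ → ℕ
    Q₁ : ∀ n → Circuit (n + ρ n) (m₁ n)
    Q₂ : ∀ n → Circuit (n + ρ n) (m₂ n)
    D  : ∀ n → Circuit ((n + ρ n) + (k₁ n + k₂ n)) 1
    O₁ : ∀ n → Vec Bool (m₁ n) → Vec Bool (k₁ n)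
    O₂ : ∀ n → Vec Bool (m₂ n) → Vec Bool (k₂ n)
    correct : ∀ n (z : Vec Bool n) (r : Vec Bool (ρ n)) →
      evalC (D n) ((z V.++ r) V.++ (O₁ n (evalC (Q₁ n) (z V.++ r)) V.++ O₂ n (evalC (Q₂ n) (z V.++ r))))
        ≡ L (V.toList z) V.∷ V.[]
    hide₁ : ∀ n (z z' : Vec Bool n) (y : Vec Bool (m₁ n)) →
      countWhere (ρ n) (λ r → eqBits (evalC (Q₁ n) (z V.++ r)) y)
        ≡ countWhere (ρ n) (λ r → eqBits (evalC (Q₁ n) (z' V.++ r)) y)
    hide₂ : ∀ n (z z' : Vec Bool n) (y : Vec Bool (m₂ n)) →
      countWhere (ρ n) (λ r → eqBits (evalC (Q₂ n) (z V.++ r)) y)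
        ≡ countWhere (ρ n) (λ r → eqBits (evalC (Q₂ n) (z' V.++ r)) y)
    efficient : ∃[ p ] (PolyBounded p × (∀ n → size (Q₁ n) + size (Q₂ n) + size (D n) ≤ p n))

{-# OPTIONS --safe #-}
-- Henry reduces his input z to x = f z with the length-regular reduction from L to the
-- NP-hard L₁, draws the randomness r of the split-hide reduction and asks the two oracles
-- about a(x, r) and b(x, r).  Playing Alice and Bob, the oracles answer with their BSM
-- messages, and Carol's circuit on the two answers decides L₂(a(x, r), b(x, r)) = L₁ x = L z.
-- As |x| depends on |z| only, each query is distributed like a(x, r), resp. b(x, r), for a
-- fixed length, hence independently of z.  Henry is a small circuit because a Turing machine
-- running T steps on an input of length n is simulated by a circuit of size polynomial in
-- n + T: the configurations fit in a window of width n + T, and a step updates every cell by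
-- a fixed local rule, realised by constant-size truth tables.
module Submission where

open import Defs
open import Algebra.Properties.CommutativeSemigroup using (interchange)
open import Data.Bool using (Bool; true; false; _∧_; _∨_; not; if_then_else_)
open import Data.Empty using (⊥-elim)
open import Data.Fin as F using (Fin; zero; suc; toℕ; _↑ˡ_; _↑ʳ_)
open import Data.List as L using (List; []; _∷_; length)
open import Data.Maybe as Maybe using (Maybe; just; nothing; maybe)
open import Data.Nat using (ℕ; NonZero; >-nonZero; zero; suc; _+_; _*_; _^_; _≤_; z≤n; s≤s; pred; _≤?_)
open import Data.Nat.Properties
open import Data.Product using (Σ; ∃; ∃-syntax; _×_; _,_; proj₁; proj₂)
open import Data.Sum using (_⊎_; inj₁; inj₂; [_,_]′)
open import Data.Vec as V using (Vec; []; _∷_; _++_; lookup; tabulate; map; toList; take; drop)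
open import Data.Vec.Properties
  using (lookup∘tabulate; tabulate∘lookup; tabulate-cong; tabulate-∘; lookup-map; lookup-splitAt;
         lookup-++ˡ; lookup-++ʳ; lookup-concat; map-++; take++drop≡id; ++-injectiveˡ; ++-injectiveʳ;
         toList-++; toList∘fromList; length-toList)
open import Data.List.Properties using (∷-injectiveˡ; ∷-injectiveʳ; length-drop)
open import Function using (_∘_)
open import Relation.Binary.PropositionalEquality
open import Relation.Nullary using (yes; no)

cong₃ : ∀ {A B C D : Set} (f : A → B → C → D) {x x′ y y′ z z′} → x ≡ x′ → y ≡ y′ → z ≡ z′ → f x y z ≡ f x′ y′ z′
cong₃ f refl refl refl = refl

appendedWire : ∀ {i g₁ k} g₂ → (Fin k → Fin (g₁ + i)) → Fin (g₂ + k) → Fin ((g₂ + g₁) + i)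
appendedWire zero     σ j       = σ j
appendedWire (suc g₂) σ zero    = zero
appendedWire (suc g₂) σ (suc j) = suc (appendedWire g₂ σ j)

olderWire : ∀ {i g₁} g₂ → Fin (g₁ + i) → Fin ((g₂ + g₁) + i)
olderWire zero     j = j
olderWire (suc g₂) j = suc (olderWire g₂ j)

renameGate : ∀ {a b} → (Fin a → Fin b) → Gate a → Gate b
renameGate τ (andG u v) = andG (τ u) (τ v)
renameGate τ (orG u v)  = orG (τ u) (τ v)
renameGate τ (notG u)   = notG (τ u)

evalGate-rename : ∀ {a b} (τ : Fin a → Fin b) (gt : Gate a) (w : Vec Bool b) (w′ : Vec Bool a) →
                  (∀ u → lookup w (τ u) ≡ lookup w′ u) → evalGate (renameGate τ gt) w ≡ evalGate gt w′
evalGate-rename τ (andG u v) w w′ e = cong₂ _∧_ (e u) (e v)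
evalGate-rename τ (orG u v)  w w′ e = cong₂ _∨_ (e u) (e v)
evalGate-rename τ (notG u)   w w′ e = cong not (e u)

appendGates : ∀ {i g₁ k g₂} → Gates i g₁ → (Fin k → Fin (g₁ + i)) → Gates k g₂ → Gates i (g₂ + g₁)
appendGates gs σ [] = gs
appendGates {g₂ = suc g₂} gs σ (hs ▷ gt) = appendGates gs σ hs ▷ renameGate (appendedWire g₂ σ) gt

readWires : ∀ {i g k} → Gates i g → (Fin k → Fin (g + i)) → Vec Bool i → Vec Bool k
readWires gs σ x = tabulate (λ j → lookup (wires gs x) (σ j))

wires-appendGates-new : ∀ {i g₁ k g₂} (gs : Gates i g₁) (σ : Fin k → Fin (g₁ + i)) (hs : Gates k g₂) x j →
  lookup (wires (appendGates gs σ hs) x) (appendedWire g₂ σ j) ≡ lookup (wires hs (readWires gs σ x)) j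
wires-appendGates-new gs σ [] x j = sym (lookup∘tabulate _ j)
wires-appendGates-new {g₂ = suc g₂} gs σ (hs ▷ gt) x zero =
  evalGate-rename (appendedWire g₂ σ) gt _ _ (wires-appendGates-new gs σ hs x)
wires-appendGates-new {g₂ = suc g₂} gs σ (hs ▷ gt) x (suc j) = wires-appendGates-new gs σ hs x j

wires-appendGates-old : ∀ {i g₁ k g₂} (gs : Gates i g₁) (σ : Fin k → Fin (g₁ + i)) (hs : Gates k g₂) x j →
  lookup (wires (appendGates gs σ hs) x) (olderWire g₂ j) ≡ lookup (wires gs x) j
wires-appendGates-old gs σ [] x j = refl
wires-appendGates-old {g₂ = suc g₂} gs σ (hs ▷ gt) x j = wires-appendGates-old gs σ hs x j

record Extension {i g₁ k o} (gs : Gates i g₁) (σ : Fin k → Fin (g₁ + i))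
                 (f : Vec Bool k → Vec Bool o) (c : ℕ) : Set where
  field
    count          : ℕ
    gates          : Gates i count
    result         : Fin o → Fin (count + i)
    embed          : Fin (g₁ + i) → Fin (count + i)
    count≤         : count ≤ g₁ + c
    result-correct : ∀ x t → lookup (wires gates x) (result t) ≡ lookup (f (readWires gs σ x)) t
    embed-correct  : ∀ x j → lookup (wires gates x) (embed j) ≡ lookup (wires gs x) j

open Extension

Realizable : (k o : ℕ) → (Vec Bool k → Vec Bool o) → ℕ → Set
Realizable k o f c = ∀ {i g₁} (gs : Gates i g₁) (σ : Fin k → Fin (g₁ + i)) → Extension gs σ f c

realize-circuit : ∀ {k o} (C : Circuit k o) → Realizable k o (evalC C) (Circuit.g C)
realize-circuit (circuit g hs os) {g₁ = g₁} gs σ = record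
  { count = g + g₁ ; gates = appendGates gs σ hs
  ; result = λ t → appendedWire g σ (lookup os t) ; embed = olderWire g
  ; count≤ = ≤-reflexive (+-comm g g₁)
  ; result-correct = λ x t → trans (wires-appendGates-new gs σ hs x (lookup os t)) (sym (lookup-map t _ os))
  ; embed-correct = wires-appendGates-old gs σ hs }

realize-select : ∀ {k k′} (τ : Fin k → Fin k′) → Realizable k′ k (λ v → tabulate (lookup v ∘ τ)) 0
realize-select τ {g₁ = g₁} gs σ = record
  { count = g₁ ; gates = gs ; result = σ ∘ τ ; embed = λ j → j
  ; count≤ = ≤-reflexive (sym (+-identityʳ g₁))
  ; result-correct = λ x t → sym (trans (lookup∘tabulate _ t) (lookup∘tabulate _ (τ t)))
  ; embed-correct = λ x j → refl }

realize-resp : ∀ {k o f f′ c c′} → (∀ v → f v ≡ f′ v) → c ≤ c′ → Realizable k o f c → Realizable k o f′ c′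
realize-resp f≗f′ c≤c′ A gs σ = let E = A gs σ in record
  { count = count E ; gates = gates E ; result = result E ; embed = embed E
  ; count≤ = ≤-trans (count≤ E) (+-monoʳ-≤ _ c≤c′)
  ; result-correct = λ x t → trans (result-correct E x t) (cong (λ v → lookup v t) (f≗f′ _))
  ; embed-correct = embed-correct E }

count≤-stacked : ∀ g c₁ {a b c₂} → a ≤ b + c₂ → b ≤ g + c₁ → a ≤ g + (c₁ + c₂)
count≤-stacked g c₁ {c₂ = c₂} a≤ b≤ = ≤-trans a≤ (≤-trans (+-monoˡ-≤ c₂ b≤) (≤-reflexive (+-assoc g c₁ c₂)))

tabulate-lookup-cong : ∀ {A : Set} {n k} (w : Vec A n) (v : Vec A k) (τ : Fin k → Fin n) →
                       (∀ t → lookup w (τ t) ≡ lookup v t) → tabulate (lookup w ∘ τ) ≡ v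
tabulate-lookup-cong w v τ e = trans (tabulate-cong e) (tabulate∘lookup v)

realize-∘ : ∀ {k m o f h c₁ c₂} → Realizable k m f c₁ → Realizable m o h c₂ →
            Realizable k o (h ∘ f) (c₁ + c₂)
realize-∘ {h = h} {c₁} A B {g₁ = g₁} gs σ = record
  { count = count E₂ ; gates = gates E₂ ; result = result E₂ ; embed = embed E₂ ∘ embed E₁
  ; count≤ = count≤-stacked g₁ c₁ (count≤ E₂) (count≤ E₁)
  ; result-correct = λ x t → trans (result-correct E₂ x t)
      (cong (λ v → lookup (h v) t) (tabulate-lookup-cong (wires (gates E₁) x) _ (result E₁) (result-correct E₁ x)))
  ; embed-correct = λ x j → trans (embed-correct E₂ x (embed E₁ j)) (embed-correct E₁ x j) }
  where
  E₁ = A gs σ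
  E₂ = B (gates E₁) (result E₁)

realize-++ : ∀ {k o₁ o₂ f₁ f₂ c₁ c₂} → Realizable k o₁ f₁ c₁ → Realizable k o₂ f₂ c₂ →
             Realizable k (o₁ + o₂) (λ v → f₁ v ++ f₂ v) (c₁ + c₂)
realize-++ {o₁ = o₁} {o₂} {f₁} {f₂} {c₁} A B {g₁ = g₁} gs σ = record
  { count = count E₂ ; gates = gates E₂ ; result = out ∘ F.splitAt o₁ ; embed = embed E₂ ∘ embed E₁
  ; count≤ = count≤-stacked g₁ c₁ (count≤ E₂) (count≤ E₁)
  ; result-correct = λ x t → trans (out-correct x (F.splitAt o₁ t))
                                    (sym (lookup-splitAt o₁ (f₁ (readWires gs σ x)) (f₂ (readWires gs σ x)) t))
  ; embed-correct = λ x j → trans (embed-correct E₂ x (embed E₁ j)) (embed-correct E₁ x j) }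
  where
  E₁ = A gs σ
  E₂ = B (gates E₁) (embed E₁ ∘ σ)
  out : Fin o₁ ⊎ Fin o₂ → Fin (count E₂ + _)
  out = [ embed E₂ ∘ result E₁ , result E₂ ]′
  out-correct : ∀ x s → lookup (wires (gates E₂) x) (out s)
                      ≡ [ lookup (f₁ (readWires gs σ x)) , lookup (f₂ (readWires gs σ x)) ]′ s
  out-correct x (inj₁ t) = trans (embed-correct E₂ x (result E₁ t)) (result-correct E₁ x t)
  out-correct x (inj₂ t) = trans (result-correct E₂ x t)
    (cong (λ v → lookup (f₂ v) t) (tabulate-cong (λ j → embed-correct E₁ x (σ j))))

iterate : ∀ {A : Set} → ℕ → (A → A) → A → A
iterate zero    f x = x
iterate (suc t) f x = iterate t f (f x)

realize-iterate : ∀ {n f c} t → Realizable n n f c → Realizable n n (iterate t f) (t * c)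
realize-iterate zero    A = realize-resp tabulate∘lookup z≤n (realize-select (λ j → j))
realize-iterate (suc t) A = realize-∘ A (realize-iterate t A)

realize-concat : ∀ {k o c} K (g : Fin K → Vec Bool k → Vec Bool o) → (∀ j → Realizable k o (g j) c) →
                 Realizable k (K * o) (λ v → V.concat (tabulate (λ j → g j v))) (K * c)
realize-concat zero    g A = realize-resp (λ v → refl) z≤n (realize-select (λ ()))
realize-concat (suc K) g A = realize-++ (A zero) (realize-concat K (g ∘ suc) (A ∘ suc))

circuitFor : ∀ {k o f c} → Realizable k o f c →
             Σ (Circuit k o) λ C → (∀ x → evalC C x ≡ f x) × size C ≤ k + c
circuitFor {k} {f = f} {c} A =
  circuit (count E) (gates E) (tabulate (result E)) ,
  (λ x → begin
     map (lookup (wires (gates E) x)) (tabulate (result E)) ≡⟨ tabulate-∘ _ (result E) ⟨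
     tabulate (lookup (wires (gates E) x) ∘ result E)      ≡⟨ tabulate-lookup-cong (wires (gates E) x) _ (result E) (result-correct E x) ⟩
     f (readWires [] (λ j → j) x)                          ≡⟨ cong f (tabulate∘lookup x) ⟩
     f x                                                   ∎) ,
  ≤-trans (≤-reflexive (+-comm k (count E))) (≤-trans (+-monoˡ-≤ k (count≤ E)) (≤-reflexive (+-comm c k)))
  where
  open ≡-Reasoning
  E = A {k} {0} [] (λ j → j)

-- A constant is computed as x ∧ ¬ x or x ∨ ¬ x from some input wire x, so the
-- gadgets below read a dummy wire in front of their actual inputs.
constCircuit : Bool → Circuit 1 1
constCircuit b = circuit 2 (([] ▷ notG zero) ▷ (if b then orG else andG) zero (suc zero)) (zero ∷ [])

evalC-constCircuit : ∀ b x → evalC (constCircuit b) (x ∷ []) ≡ b ∷ []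
evalC-constCircuit false false = refl
evalC-constCircuit false true  = refl
evalC-constCircuit true  false = refl
evalC-constCircuit true  true  = refl

realize-const : ∀ {k} b → Realizable (suc k) 1 (λ _ → b ∷ []) 2
realize-const b = realize-resp (λ v → evalC-constCircuit b (lookup v zero)) ≤-refl
  (realize-∘ (realize-select {1} (λ _ → zero)) (realize-circuit (constCircuit b)))

realize-constVec : ∀ {k n} (w : Vec Bool n) → Realizable (suc k) n (λ _ → w) (n * 2)
realize-constVec []      = realize-select (λ ())
realize-constVec (b ∷ w) = realize-++ (realize-const b) (realize-constVec w)

muxCircuit : Circuit 3 1
muxCircuit = circuit 4 (((([] ▷ notG zero) ▷ andG (suc zero) (suc (suc zero)))
                         ▷ andG (suc zero) (suc (suc (suc (suc zero))))) ▷ orG zero (suc zero)) (zero ∷ [])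

evalC-muxCircuit : ∀ b x y → evalC muxCircuit (b ∷ x ∷ y ∷ []) ≡ (if b then x else y) ∷ []
evalC-muxCircuit true  true  y     = refl
evalC-muxCircuit true  false y     = refl
evalC-muxCircuit false x     true  = refl
evalC-muxCircuit false x     false = refl

truthTableSize : ℕ → ℕ
truthTableSize zero    = 2
truthTableSize (suc m) = truthTableSize m + truthTableSize m + 4

-- Shannon expansion on the first argument.
realize-truthTable : ∀ {m} (g : Vec Bool m → Bool) →
                     Realizable (suc m) 1 (λ v → g (V.tail v) ∷ []) (truthTableSize m)
realize-truthTable {zero} g = realize-resp (λ { (_ ∷ []) → refl }) ≤-refl (realize-const (g []))
realize-truthTable {suc m} g = realize-resp expand ≤-refl
  (realize-∘ (realize-++ (realize-select {1} (λ _ → suc zero))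
                         (realize-++ (realize-∘ (realize-select skipFirst) (realize-truthTable (g ∘ (true ∷_))))
                                     (realize-∘ (realize-select skipFirst) (realize-truthTable (g ∘ (false ∷_))))))
             (realize-circuit muxCircuit))
  where
  skipFirst : Fin (suc m) → Fin (suc (suc m))
  skipFirst zero    = zero
  skipFirst (suc j) = suc (suc j)
  expand : ∀ v → evalC muxCircuit (lookup v (suc zero) ∷ g (true ∷ tabulate (λ j → lookup v (suc (suc j))))
                                              ∷ g (false ∷ tabulate (λ j → lookup v (suc (suc j)))) ∷ [])
               ≡ g (V.tail v) ∷ []
  expand (a ∷ true  ∷ w) rewrite tabulate∘lookup w = evalC-muxCircuit true  (g (true ∷ w)) (g (false ∷ w))
  expand (a ∷ false ∷ w) rewrite tabulate∘lookup w = evalC-muxCircuit false (g (true ∷ w)) (g (false ∷ w))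

realize-truthTables : ∀ {m o} (g : Vec Bool m → Vec Bool o) →
                      Realizable (suc m) o (g ∘ V.tail) (o * truthTableSize m)
realize-truthTables {o = zero} g = realize-resp (λ v → empty (g (V.tail v))) z≤n (realize-select (λ ()))
  where
  empty : (w : Vec Bool 0) → [] ≡ w
  empty [] = refl
realize-truthTables {o = suc o} g = realize-resp (λ v → head∷tail (g (V.tail v))) ≤-refl
  (realize-++ (realize-truthTable (V.head ∘ g)) (realize-truthTables (V.tail ∘ g)))
  where
  head∷tail : (w : Vec Bool (suc o)) → V.head w ∷ V.tail w ≡ w
  head∷tail (_ ∷ _) = refl

-- Wire zero is the dummy wire the truth tables need.
realize-local : ∀ {k m o} {pick : Vec Bool (suc k) → Vec Bool m} → Realizable (suc k) m pick 0 →
                (g : Vec Bool m → Vec Bool o) → Realizable (suc k) o (g ∘ pick) (o * truthTableSize m)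
realize-local P g = realize-∘ (realize-++ (realize-select {1} (λ _ → zero)) P) (realize-truthTables g)

-- (1 + c + n) ^ (1 + c) is monotone in c, so closure under +, * and ∘ only needs a larger c.
powerBound : ℕ → ℕ → ℕ
powerBound c n = (suc c + n) ^ suc c

PowerBounded : (ℕ → ℕ) → Set
PowerBounded f = Σ ℕ λ c → ∀ n → f n ≤ powerBound c n

^-mono-≤ : ∀ {a b e e′} → 1 ≤ b → a ≤ b → e ≤ e′ → a ^ e ≤ b ^ e′
^-mono-≤ {b = suc b} {e} _ a≤b e≤e′ = ≤-trans (^-monoˡ-≤ e a≤b) (^-monoʳ-≤ (suc b) e≤e′)

m≤m^[1+n] : ∀ m n → 1 ≤ m → m ≤ m ^ suc n
m≤m^[1+n] (suc m) n _ = m≤m*n (suc m) (suc m ^ n) {{m^n≢0 (suc m) n}}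

powerBound-mono : ∀ {c c′ n n′} → c ≤ c′ → n ≤ n′ → powerBound c n ≤ powerBound c′ n′
powerBound-mono c≤c′ n≤n′ = ^-mono-≤ (s≤s z≤n) (s≤s (+-mono-≤ c≤c′ n≤n′)) (s≤s c≤c′)

powerBound-+ : ∀ c n → powerBound c n + powerBound c n ≤ powerBound (suc c) n
powerBound-+ c n = ≤-trans (+-mono-≤ p≤y (≤-trans p≤y (≤-reflexive (sym (+-identityʳ y)))))
                           (*-monoˡ-≤ y {2} {suc (suc c + n)} (s≤s (s≤s z≤n)))
  where
  y = suc (suc c + n) ^ suc c
  p≤y : powerBound c n ≤ y
  p≤y = ^-monoˡ-≤ (suc c) (n≤1+n _)

powerBound-* : ∀ c n → powerBound c n * powerBound c n ≤ powerBound (suc (c + c)) n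
powerBound-* c n = ≤-trans (≤-reflexive (sym (^-distribˡ-+-* (suc c + n) (suc c) (suc c))))
  (^-mono-≤ (s≤s z≤n) (s≤s (+-monoˡ-≤ n (≤-trans (m≤m+n c c) (n≤1+n _)))) (≤-reflexive (cong suc (+-suc c c))))

+-^-≤ : ∀ x u e → 1 ≤ u → x + u ^ suc e ≤ (x + u) ^ suc e
+-^-≤ x u zero    _   = ≤-reflexive (trans (cong (x +_) (*-identityʳ u)) (sym (*-identityʳ (x + u))))
+-^-≤ x u@(suc _) (suc e) 1≤u = begin
  x + u * u ^ suc e               ≤⟨ +-mono-≤ (m≤m*n x a {{a≢0}}) (*-monoʳ-≤ u (m≤n+m (u ^ suc e) x)) ⟩
  x * a + u * a                   ≡⟨ *-distribʳ-+ a x u ⟨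
  (x + u) * a                     ≤⟨ *-monoʳ-≤ (x + u) (+-^-≤ x u e 1≤u) ⟩
  (x + u) * (x + u) ^ suc e       ∎
  where
  open ≤-Reasoning
  a = x + u ^ suc e
  a≢0 : NonZero a
  a≢0 = >-nonZero (≤-trans (m^n>0 u (suc e)) (m≤n+m (u ^ suc e) x))

PowerBounded-mono : ∀ {f g} → (∀ n → f n ≤ g n) → PowerBounded g → PowerBounded f
PowerBounded-mono f≤g (c , g≤) = c , λ n → ≤-trans (f≤g n) (g≤ n)

PowerBounded-const : ∀ k → PowerBounded (λ _ → k)
PowerBounded-const k = k , λ n → ≤-trans (≤-trans (n≤1+n k) (m≤m+n (suc k) n)) (m≤m^[1+n] (suc k + n) k (s≤s z≤n))

PowerBounded-id : PowerBounded (λ n → n)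
PowerBounded-id = 0 , λ n → ≤-trans (n≤1+n n) (≤-reflexive (sym (*-identityʳ (suc n))))

PowerBounded-+ : ∀ {f g} → PowerBounded f → PowerBounded g → PowerBounded (λ n → f n + g n)
PowerBounded-+ (c , f≤) (c′ , g≤) = suc (c + c′) , λ n →
  ≤-trans (+-mono-≤ (≤-trans (f≤ n) (powerBound-mono (m≤m+n c c′) ≤-refl))
                    (≤-trans (g≤ n) (powerBound-mono (m≤n+m c′ c) ≤-refl)))
          (powerBound-+ (c + c′) n)

PowerBounded-* : ∀ {f g} → PowerBounded f → PowerBounded g → PowerBounded (λ n → f n * g n)
PowerBounded-* (c , f≤) (c′ , g≤) = suc ((c + c′) + (c + c′)) , λ n →
  ≤-trans (*-mono-≤ (≤-trans (f≤ n) (powerBound-mono (m≤m+n c c′) ≤-refl))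
                    (≤-trans (g≤ n) (powerBound-mono (m≤n+m c′ c) ≤-refl)))
          (powerBound-* (c + c′) n)

PowerBounded-∘ : ∀ {f g} → PowerBounded f → PowerBounded g → PowerBounded (f ∘ g)
PowerBounded-∘ {f} {g} (c , f≤) (c′ , g≤) = d , λ n → begin
  f (g n)                                     ≤⟨ f≤ (g n) ⟩
  (suc c + g n) ^ suc c                       ≤⟨ ^-monoˡ-≤ (suc c) (+-monoʳ-≤ (suc c) (g≤ n)) ⟩
  (suc c + (suc c′ + n) ^ suc c′) ^ suc c     ≤⟨ ^-monoˡ-≤ (suc c) (+-^-≤ (suc c) (suc c′ + n) c′ (s≤s z≤n)) ⟩
  ((suc c + (suc c′ + n)) ^ suc c′) ^ suc c   ≡⟨ ^-*-assoc (suc c + (suc c′ + n)) (suc c′) (suc c) ⟩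
  (suc c + (suc c′ + n)) ^ (suc c′ * suc c)   ≤⟨ ^-mono-≤ (s≤s z≤n) base≤ (≤-trans (m≤m+n _ (suc c + suc c′)) (n≤1+n d)) ⟩
  powerBound d n                              ∎
  where
  open ≤-Reasoning
  d = suc c′ * suc c + (suc c + suc c′)
  base≤ : ∀ {n} → suc c + (suc c′ + n) ≤ suc d + n
  base≤ {n} = ≤-trans (≤-reflexive (sym (+-assoc (suc c) (suc c′) n)))
                  (+-monoˡ-≤ n (≤-trans (m≤n+m _ (suc c′ * suc c)) (n≤1+n d)))

PolyBounded⇒PowerBounded : ∀ {f} → PolyBounded f → PowerBounded f
PolyBounded⇒PowerBounded {f} (k , f≤) = k + k , bound
  where
  bound : ∀ n → f n ≤ powerBound (k + k) n
  bound n = begin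
    f n                   ≤⟨ f≤ n ⟩
    k * n ^ k + k         ≤⟨ +-mono-≤ (*-monoʳ-≤ k (^-mono-≤ (s≤s z≤n) (m≤n+m n (suc (k + k))) (m≤m+n k k)))
                                      (m≤m*n k y {{m^n≢0 b (k + k)}}) ⟩
    k * y + k * y         ≡⟨ *-distribʳ-+ y k k ⟨
    (k + k) * y           ≤⟨ *-monoˡ-≤ y (≤-trans (n≤1+n (k + k)) (m≤m+n (suc (k + k)) n)) ⟩
    b * y                 ∎
    where
    open ≤-Reasoning
    b = suc (k + k) + n
    y = b ^ (k + k)

^-distribʳ-* : ∀ m n e → (m * n) ^ e ≡ m ^ e * n ^ e
^-distribʳ-* m n zero    = refl
^-distribʳ-* m n (suc e) =
  trans (cong ((m * n) *_) (^-distribʳ-* m n e)) (interchange *-commutativeSemigroup m n (m ^ e) (n ^ e))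

-- Up to n = 1 + c the bound is at most (2 + 2 c) ^ (1 + c); beyond, 1 + c + n ≤ 2 n.
PowerBounded⇒PolyBounded : ∀ {f} → PowerBounded f → PolyBounded f
PowerBounded⇒PolyBounded {f} (c , f≤) = K , λ n → ≤-trans (f≤ n) (bound n)
  where
  a = suc c
  K = (a + a) ^ a + a
  bound : ∀ n → powerBound c n ≤ K * n ^ K + K
  bound n with n ≤? a
  ... | yes n≤a = ≤-trans (^-monoˡ-≤ a (+-monoʳ-≤ a n≤a)) (≤-trans (m≤m+n _ a) (m≤n+m K (K * n ^ K)))
  ... | no n≰a = begin
    (a + n) ^ a       ≤⟨ ^-monoˡ-≤ a (+-monoˡ-≤ n (<⇒≤ a<n)) ⟩
    (n + n) ^ a       ≡⟨ cong (λ m → (n + m) ^ a) (sym (+-identityʳ n)) ⟩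
    (2 * n) ^ a       ≡⟨ ^-distribʳ-* 2 n a ⟩
    2 ^ a * n ^ a     ≤⟨ *-mono-≤ (≤-trans (^-monoˡ-≤ a (s≤s (≤-trans (s≤s z≤n) (m≤n+m a c)))) (m≤m+n ((a + a) ^ a) a))
                                  (^-mono-≤ (≤-trans (s≤s z≤n) a<n) ≤-refl (m≤n+m a ((a + a) ^ a))) ⟩
    K * n ^ K         ≤⟨ m≤m+n (K * n ^ K) K ⟩
    K * n ^ K + K     ∎
    where
    open ≤-Reasoning
    a<n = ≰⇒> n≰a

-- Turing machines confined to a window of fixed width

cellAt : List Sym → ℕ → Sym
cellAt []       _       = blank
cellAt (s ∷ ss) zero    = s
cellAt (s ∷ ss) (suc j) = cellAt ss j

cellAt-drop1 : ∀ l j → cellAt (L.drop 1 l) j ≡ cellAt l (suc j)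
cellAt-drop1 []      j = refl
cellAt-drop1 (_ ∷ _) j = refl

windowCellAt : ∀ {K} → Vec Sym K → ℕ → Sym
windowCellAt []       _       = blank
windowCellAt (s ∷ ss) zero    = s
windowCellAt (s ∷ ss) (suc j) = windowCellAt ss j

window : ∀ K → List Sym → Vec Sym K
window K l = tabulate (cellAt l ∘ toℕ)

windowCellAt-window : ∀ K l j → length l ≤ K → windowCellAt (window K l) j ≡ cellAt l j
windowCellAt-window zero    []      j       _         = refl
windowCellAt-window (suc K) l       zero    _         = refl
windowCellAt-window (suc K) []      (suc j) _         = windowCellAt-window K [] j z≤n
windowCellAt-window (suc K) (s ∷ l) (suc j) (s≤s l≤K) = windowCellAt-window K l j l≤K

decSym≡just : ∀ s {b} → decSym s ≡ just b → s ≡ encBit b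
decSym≡just (suc zero)       refl = refl
decSym≡just (suc (suc zero)) refl = refl
decSym≡just zero ()
decSym≡just (suc (suc (suc zero))) ()

readBits-cellAt : ∀ h rs {O} (v : Vec Bool O) → readBits h rs ≡ toList v →
                  ∀ j → cellAt (h ∷ rs) (toℕ j) ≡ encBit (lookup v j)
readBits-cellAt h rs (b ∷ v) e j with decSym h in h≡
... | nothing with () ← e
readBits-cellAt h rs (b ∷ v) e j | just _ with rs
readBits-cellAt h rs (b ∷ v)  e zero    | just _ | []      = trans (decSym≡just h h≡) (cong encBit (∷-injectiveˡ e))
readBits-cellAt h rs (b ∷ []) e (suc ()) | just _ | []
readBits-cellAt h rs (b ∷ v)  e zero    | just _ | r ∷ rs′ = trans (decSym≡just h h≡) (cong encBit (∷-injectiveˡ e))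
readBits-cellAt h rs (b ∷ v)  e (suc j) | just _ | r ∷ rs′ = readBits-cellAt r rs′ v (∷-injectiveʳ e) j

length-readBits : ∀ h rs → length (readBits h rs) ≤ suc (length rs)
length-readBits h rs with decSym h
... | nothing = z≤n
... | just b with rs
...   | []      = ≤-refl
...   | r ∷ rs′ = s≤s (length-readBits r rs′)

module Windowed (M : TM) where

  State : Set
  State = Fin (suc (TM.Q M))

  halted : State → Bool
  halted = TM.halting M

  δ : State → Sym → State × Sym × Move
  δ = TM.δ M

  record Snapshot (K : ℕ) : Set where
    constructor snapshot
    field
      state  : State
      head   : Sym
      lefts  : Vec Sym K
      rights : Vec Sym K

  cong-snapshot : ∀ {K q q′ h h′} {L L′ R R′ : Vec Sym K} →
                  q ≡ q′ → h ≡ h′ → L ≡ L′ → R ≡ R′ → snapshot q h L R ≡ snapshot q′ h′ L′ R′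
  cong-snapshot refl refl refl refl = refl

  headUpdate : (hlt : Bool) → State × Sym × Move → (q : State) (h nearestLeft nearestRight : Sym) → State × Sym
  headUpdate true  _                q h l r = q , h
  headUpdate false (q′ , w , left)  q h l r = q′ , l
  headUpdate false (q′ , w , right) q h l r = q′ , r
  headUpdate false (q′ , w , stay)  q h l r = q′ , w

  leftUpdate rightUpdate : (hlt : Bool) → State × Sym × Move → (adjacent : Bool) (inner cell outer : Sym) → Sym
  leftUpdate true  _                z     x y u = y
  leftUpdate false (q′ , w , left)  z     x y u = u
  leftUpdate false (q′ , w , right) true  x y u = w
  leftUpdate false (q′ , w , right) false x y u = x
  leftUpdate false (q′ , w , stay)  z     x y u = y
  rightUpdate true  _                z     x y u = y
  rightUpdate false (q′ , w , right) z     x y u = u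
  rightUpdate false (q′ , w , left)  true  x y u = w
  rightUpdate false (q′ , w , left)  false x y u = x
  rightUpdate false (q′ , w , stay)  z     x y u = y

  nextToHead : ∀ {K} → Fin K → Bool
  nextToHead zero    = true
  nextToHead (suc _) = false

  -- Next to the head the inner neighbour is junk (pred 0 = 0); the rules ignore it there.
  updateCell : ∀ {K} → (Bool → Sym → Sym → Sym → Sym) → Vec Sym K → Fin K → Sym
  updateCell F S i = F (nextToHead i) (windowCellAt S (pred (toℕ i))) (lookup S i) (windowCellAt S (suc (toℕ i)))

  snapStepWith : ∀ {K} → Bool → State × Sym × Move → State → Sym → Vec Sym K → Vec Sym K → Snapshot K
  snapStepWith hlt d q h L R =
    snapshot (proj₁ (headUpdate hlt d q h (windowCellAt L 0) (windowCellAt R 0)))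
             (proj₂ (headUpdate hlt d q h (windowCellAt L 0) (windowCellAt R 0)))
             (tabulate (updateCell (leftUpdate hlt d) L)) (tabulate (updateCell (rightUpdate hlt d) R))

  snapStep : ∀ {K} → Snapshot K → Snapshot K
  snapStep (snapshot q h L R) = snapStepWith (halted q) (δ q h) q h L R

  snapRun : ∀ {K} → ℕ → Snapshot K → Snapshot K
  snapRun zero    s = s
  snapRun (suc t) s = snapRun t (snapStep s)

  snapshotOf : ∀ K → Config M → Snapshot K
  snapshotOf K (config q ls h rs) = snapshot q h (window K ls) (window K rs)

  tapeLength : Config M → ℕ
  tapeLength (config q ls h rs) = length ls + length rs

  stepWith : Bool → State × Sym × Move → State → List Sym → Sym → List Sym → Config M
  stepWith true  d            q ls h rs = config q ls h rs
  stepWith false (q′ , w , mv) q ls h rs = moveHead {M} q′ ls w rs mv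

  step≡stepWith : ∀ q ls h rs → step M (config q ls h rs) ≡ stepWith (halted q) (δ q h) q ls h rs
  step≡stepWith q ls h rs with halted q
  ... | true  = refl
  ... | false with δ q h
  ...   | (q′ , w , mv) = refl

  moveHead-left : ∀ q ls w rs → moveHead {M} q ls w rs left ≡ config q (L.drop 1 ls) (cellAt ls 0) (w ∷ rs)
  moveHead-left q []      w rs = refl
  moveHead-left q (_ ∷ _) w rs = refl

  moveHead-right : ∀ q ls w rs → moveHead {M} q ls w rs right ≡ config q (w ∷ ls) (cellAt rs 0) (L.drop 1 rs)
  moveHead-right q []      w []      = refl
  moveHead-right q []      w (_ ∷ _) = refl
  moveHead-right q (_ ∷ _) w []      = refl
  moveHead-right q (_ ∷ _) w (_ ∷ _) = refl

  moveHead-stay : ∀ q ls w rs → moveHead {M} q ls w rs stay ≡ config q ls w rs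
  moveHead-stay q []      w []      = refl
  moveHead-stay q []      w (_ ∷ _) = refl
  moveHead-stay q (_ ∷ _) w []      = refl
  moveHead-stay q (_ ∷ _) w (_ ∷ _) = refl

  window-keep : ∀ K (F : Bool → Sym → Sym → Sym → Sym) l → (∀ z x y u → F z x y u ≡ y) →
                window K l ≡ tabulate (updateCell F (window K l))
  window-keep K F l F≡y = sym (trans (tabulate-cong (λ i → F≡y _ _ _ _)) (tabulate∘lookup (window K l)))

  window-pop : ∀ K (F : Bool → Sym → Sym → Sym → Sym) l → length l ≤ K → (∀ z x y u → F z x y u ≡ u) →
               window K (L.drop 1 l) ≡ tabulate (updateCell F (window K l))
  window-pop K F l l≤K F≡u = tabulate-cong λ i →
    trans (cellAt-drop1 l (toℕ i)) (sym (trans (F≡u _ _ _ _) (windowCellAt-window K l (suc (toℕ i)) l≤K)))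

  window-push : ∀ K (F : Bool → Sym → Sym → Sym → Sym) w l → length l ≤ K →
                (∀ x y u → F true x y u ≡ w) → (∀ x y u → F false x y u ≡ x) →
                window K (w ∷ l) ≡ tabulate (updateCell F (window K l))
  window-push K F w l l≤K F-first F-later = tabulate-cong cell
    where
    cell : ∀ i → cellAt (w ∷ l) (toℕ i) ≡ updateCell F (window K l) i
    cell zero    = sym (F-first _ _ _)
    cell (suc i) = sym (trans (F-later _ _ _) (windowCellAt-window K l (toℕ i) l≤K))

  snapshotOf-stepWith : ∀ K hlt d q ls h rs → length ls ≤ K → length rs ≤ K →
    snapshotOf K (stepWith hlt d q ls h rs) ≡ snapStepWith hlt d q h (window K ls) (window K rs)
  snapshotOf-stepWith K true d q ls h rs _ _ =
    cong-snapshot refl refl (window-keep K (leftUpdate true d) ls λ _ _ _ _ → refl)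
                            (window-keep K (rightUpdate true d) rs λ _ _ _ _ → refl)
  snapshotOf-stepWith K false (q′ , w , left) q ls h rs ls≤K rs≤K rewrite moveHead-left q′ ls w rs =
    cong-snapshot refl (sym (windowCellAt-window K ls 0 ls≤K))
      (window-pop K (leftUpdate false (q′ , w , left)) ls ls≤K λ _ _ _ _ → refl) (window-push K (rightUpdate false (q′ , w , left)) w rs rs≤K (λ _ _ _ → refl) (λ _ _ _ → refl))
  snapshotOf-stepWith K false (q′ , w , right) q ls h rs ls≤K rs≤K rewrite moveHead-right q′ ls w rs =
    cong-snapshot refl (sym (windowCellAt-window K rs 0 rs≤K))
      (window-push K (leftUpdate false (q′ , w , right)) w ls ls≤K (λ _ _ _ → refl) (λ _ _ _ → refl)) (window-pop K (rightUpdate false (q′ , w , right)) rs rs≤K λ _ _ _ _ → refl)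
  snapshotOf-stepWith K false d@(q′ , w , stay) q ls h rs _ _ rewrite moveHead-stay q′ ls w rs =
    cong-snapshot refl refl (window-keep K (leftUpdate false d) ls λ _ _ _ _ → refl)
                            (window-keep K (rightUpdate false d) rs λ _ _ _ _ → refl)

  snapshotOf-step : ∀ K c → tapeLength c ≤ K → snapshotOf K (step M c) ≡ snapStep (snapshotOf K c)
  snapshotOf-step K (config q ls h rs) len≤K rewrite step≡stepWith q ls h rs =
    snapshotOf-stepWith K (halted q) (δ q h) q ls h rs (≤-trans (m≤m+n _ _) len≤K) (≤-trans (m≤n+m _ _) len≤K)

  length-drop1 : ∀ (l : List Sym) → length (L.drop 1 l) ≤ length l
  length-drop1 l = ≤-trans (≤-reflexive (length-drop 1 l)) (m∸n≤m (length l) 1)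

  tapeLength-stepWith : ∀ hlt d q ls h rs → tapeLength (stepWith hlt d q ls h rs) ≤ suc (length ls + length rs)
  tapeLength-stepWith true d q ls h rs = n≤1+n _
  tapeLength-stepWith false (q′ , w , left) q ls h rs rewrite moveHead-left q′ ls w rs =
    ≤-trans (≤-reflexive (+-suc (length (L.drop 1 ls)) (length rs))) (s≤s (+-monoˡ-≤ (length rs) (length-drop1 ls)))
  tapeLength-stepWith false (q′ , w , right) q ls h rs rewrite moveHead-right q′ ls w rs =
    s≤s (+-monoʳ-≤ (length ls) (length-drop1 rs))
  tapeLength-stepWith false (q′ , w , stay) q ls h rs rewrite moveHead-stay q′ ls w rs = n≤1+n _

  tapeLength-step : ∀ c → tapeLength (step M c) ≤ suc (tapeLength c)
  tapeLength-step (config q ls h rs) rewrite step≡stepWith q ls h rs = tapeLength-stepWith (halted q) (δ q h) q ls h rs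

  tapeLength-run : ∀ t c → tapeLength (run M t c) ≤ tapeLength c + t
  tapeLength-run zero    c = ≤-reflexive (sym (+-identityʳ _))
  tapeLength-run (suc t) c = ≤-trans (tapeLength-run t (step M c))
    (≤-trans (+-monoˡ-≤ t (tapeLength-step c)) (≤-reflexive (sym (+-suc (tapeLength c) t))))

  snapshotOf-run : ∀ K t c → tapeLength c + t ≤ K → snapshotOf K (run M t c) ≡ snapRun t (snapshotOf K c)
  snapshotOf-run K zero    c _   = refl
  snapshotOf-run K (suc t) c len≤K = trans
    (snapshotOf-run K t (step M c)
      (≤-trans (+-monoˡ-≤ t (tapeLength-step c)) (≤-trans (≤-reflexive (sym (+-suc (tapeLength c) t))) len≤K)))
    (cong (snapRun t) (snapshotOf-step K c (≤-trans (m≤m+n _ _) len≤K)))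

  step-halted : ∀ c → halted (Config.state c) ≡ true → step M c ≡ c
  step-halted (config q ls h rs) e rewrite step≡stepWith q ls h rs | e = refl

  run-halted : ∀ d c → halted (Config.state c) ≡ true → run M d c ≡ c
  run-halted zero    c e = refl
  run-halted (suc d) c e rewrite step-halted c e = run-halted d c e

  run-+ : ∀ t d c → run M (t + d) c ≡ run M d (run M t c)
  run-+ zero    d c = refl
  run-+ (suc t) d c = run-+ t d (step M c)

  tapeLength-init : ∀ inp → tapeLength (initConfig M inp) ≤ length inp
  tapeLength-init []      = z≤n
  tapeLength-init (_ ∷ _) = n≤1+n _

  outputCellAt : ∀ {K} → Snapshot K → ℕ → Sym
  outputCellAt (snapshot q h L R) zero    = h
  outputCellAt (snapshot q h L R) (suc j) = windowCellAt R j

  outputCellAt-snapshotOf : ∀ K c → tapeLength c ≤ K →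
                            ∀ j → outputCellAt (snapshotOf K c) j ≡ cellAt (Config.head c ∷ Config.rights c) j
  outputCellAt-snapshotOf K (config q ls h rs) _     zero    = refl
  outputCellAt-snapshotOf K (config q ls h rs) len≤K (suc j) = windowCellAt-window K rs j (≤-trans (m≤n+m _ _) len≤K)

  -- A halted machine stays put, so after T ≥ t steps the window shows the output of step t.
  snapRun-output : ∀ K T inp {O} (v : Vec Bool O) → ComputesWithin M T inp (toList v) → length inp + T ≤ K →
                   ∀ j → outputCellAt (snapRun T (snapshotOf K (initConfig M inp))) (toℕ j) ≡ encBit (lookup v j)
  snapRun-output K T inp v (t , t≤T , halts , out≡) len≤K j = begin
    outputCellAt (snapRun T (snapshotOf K c₀)) (toℕ j) ≡⟨ cong (λ s → outputCellAt s (toℕ j)) (snapshotOf-run K T c₀ c₀≤) ⟨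
    outputCellAt (snapshotOf K (run M T c₀)) (toℕ j)   ≡⟨ cong (λ c → outputCellAt (snapshotOf K c) (toℕ j)) runT≡runt ⟩
    outputCellAt (snapshotOf K cₜ) (toℕ j)              ≡⟨ outputCellAt-snapshotOf K cₜ cₜ≤ (toℕ j) ⟩
    cellAt (Config.head cₜ ∷ Config.rights cₜ) (toℕ j) ≡⟨ readBits-cellAt _ _ v out≡ j ⟩
    encBit (lookup v j)                                ∎
    where
    open ≡-Reasoning
    c₀ = initConfig M inp
    cₜ = run M t c₀
    c₀≤ : tapeLength c₀ + T ≤ K
    c₀≤ = ≤-trans (+-monoˡ-≤ T (tapeLength-init inp)) len≤K
    cₜ≤ : tapeLength cₜ ≤ K
    cₜ≤ = ≤-trans (tapeLength-run t c₀) (≤-trans (+-monoʳ-≤ (tapeLength c₀) t≤T) c₀≤)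
    runT≡runt : run M T c₀ ≡ cₜ
    runT≡runt with d , t+d≡T ← m≤n⇒∃[o]m+o≡n t≤T =
      trans (cong (λ s → run M s c₀) (sym t+d≡T)) (trans (run-+ t d c₀) (run-halted d cₜ halts))

  length-output≤ : ∀ T inp out → ComputesWithin M T inp out → length out ≤ suc (length inp + T)
  length-output≤ T inp out (t , t≤T , _ , out≡) = begin
    length out                                            ≡⟨ cong length out≡ ⟨
    length (readBits (Config.head cₜ) (Config.rights cₜ)) ≤⟨ length-readBits (Config.head cₜ) (Config.rights cₜ) ⟩
    suc (length (Config.rights cₜ))                       ≤⟨ s≤s (m≤n+m _ _) ⟩
    suc (tapeLength cₜ)                                   ≤⟨ s≤s (tapeLength-run t _) ⟩
    suc (tapeLength (initConfig M inp) + t)               ≤⟨ s≤s (+-mono-≤ (tapeLength-init inp) t≤T) ⟩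
    suc (length inp + T)                                  ∎
    where
    open ≤-Reasoning
    cₜ = run M t (initConfig M inp)

take-++ : ∀ {A : Set} {m n} (xs : Vec A m) (ys : Vec A n) → take m (xs ++ ys) ≡ xs
take-++ {m = m} xs ys = ++-injectiveˡ (take m (xs ++ ys)) xs (take++drop≡id m (xs ++ ys))

drop-++ : ∀ {A : Set} {m n} (xs : Vec A m) (ys : Vec A n) → drop m (xs ++ ys) ≡ ys
drop-++ {m = m} xs ys = ++-injectiveʳ (take m (xs ++ ys)) xs (take++drop≡id m (xs ++ ys))

encodeState : ∀ {n} → Fin (suc n) → Vec Bool (suc n)
encodeState zero            = true ∷ V.replicate _ false
encodeState {suc n} (suc j) = false ∷ encodeState j

decodeState : ∀ {n} → Vec Bool (suc n) → Fin (suc n)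
decodeState {zero}  _           = zero
decodeState {suc n} (true ∷ _)  = zero
decodeState {suc n} (false ∷ w) = suc (decodeState w)

decodeState-encodeState : ∀ {n} (j : Fin (suc n)) → decodeState (encodeState j) ≡ j
decodeState-encodeState {zero}  zero    = refl
decodeState-encodeState {suc n} zero    = refl
decodeState-encodeState {suc n} (suc j) = cong suc (decodeState-encodeState j)

encodeSym : Sym → Vec Bool 2
encodeSym zero                   = false ∷ false ∷ []
encodeSym (suc zero)             = true ∷ false ∷ []
encodeSym (suc (suc zero))       = true ∷ true ∷ []
encodeSym (suc (suc (suc zero))) = false ∷ true ∷ []

decodeSym : Vec Bool 2 → Sym
decodeSym (false ∷ false ∷ []) = blank
decodeSym (true  ∷ false ∷ []) = sym0
decodeSym (true  ∷ true  ∷ []) = sym1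
decodeSym (false ∷ true  ∷ []) = sep

decodeSym-encodeSym : ∀ s → decodeSym (encodeSym s) ≡ s
decodeSym-encodeSym zero                   = refl
decodeSym-encodeSym (suc zero)             = refl
decodeSym-encodeSym (suc (suc zero))       = refl
decodeSym-encodeSym (suc (suc (suc zero))) = refl

encodeSym-encBit : ∀ b → encodeSym (encBit b) ≡ true ∷ b ∷ []
encodeSym-encBit false = refl
encodeSym-encBit true  = refl

lookup-encodeSym-encBit : ∀ {s b} → s ≡ encBit b → lookup (encodeSym s) (suc zero) ≡ b
lookup-encodeSym-encBit {b = b} refl = cong (λ w → lookup w (suc zero)) (encodeSym-encBit b)

encodeTape : ∀ {K} → Vec Sym K → Vec Bool (K * 2)
encodeTape S = V.concat (map encodeSym S)

lookup-encodeTape : ∀ {K} (S : Vec Sym K) i b → lookup (encodeTape S) (F.combine i b) ≡ lookup (encodeSym (lookup S i)) b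
lookup-encodeTape S i b = trans (lookup-concat (map encodeSym S) i b) (cong (λ w → lookup w b) (lookup-map i encodeSym S))

cellIndex : ∀ K → ℕ → Maybe (Fin K)
cellIndex zero    _       = nothing
cellIndex (suc K) zero    = just zero
cellIndex (suc K) (suc j) = Maybe.map suc (cellIndex K j)

windowCellAt-cellIndex : ∀ {K} (S : Vec Sym K) j → windowCellAt S j ≡ maybe (lookup S) blank (cellIndex K j)
windowCellAt-cellIndex []      j       = refl
windowCellAt-cellIndex (_ ∷ S) zero    = refl
windowCellAt-cellIndex {suc K} (_ ∷ S) (suc j) with cellIndex K j | windowCellAt-cellIndex S j
... | just _  | e = e
... | nothing | e = e

onHalves : ∀ {A X : Set} {a b} → (Vec A a → Vec A b → X) → Vec A (a + b) → X
onHalves {a = a} f u = f (take a u) (drop a u)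

onHalves-++ : ∀ {A X : Set} {a b} (f : Vec A a → Vec A b → X) xs ys → onHalves f (xs ++ ys) ≡ f xs ys
onHalves-++ f xs ys = cong₂ f (take-++ xs ys) (drop-++ xs ys)

onHalves³ : ∀ {A X : Set} {a b c d} → (Vec A a → Vec A b → Vec A c → Vec A d → X) →
            Vec A (a + (b + (c + d))) → X
onHalves³ f = onHalves λ x → onHalves λ y → onHalves (f x y)

onHalves³-++ : ∀ {A X : Set} {a b c d} (f : Vec A a → Vec A b → Vec A c → Vec A d → X) xs ys zs ws →
               onHalves³ f (xs ++ (ys ++ (zs ++ ws))) ≡ f xs ys zs ws
onHalves³-++ f xs ys zs ws =
  trans (onHalves-++ (λ x → onHalves λ y → onHalves (f x y)) xs (ys ++ (zs ++ ws)))
        (trans (onHalves-++ (λ y → onHalves (f xs y)) ys (zs ++ ws)) (onHalves-++ (f xs ys) zs ws))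

onHalves⁴ : ∀ {A X : Set} {a b c d e} → (Vec A a → Vec A b → Vec A c → Vec A d → Vec A e → X) →
            Vec A (a + (b + (c + (d + e)))) → X
onHalves⁴ f = onHalves λ x → onHalves³ (f x)

onHalves⁴-++ : ∀ {A X : Set} {a b c d e} (f : Vec A a → Vec A b → Vec A c → Vec A d → Vec A e → X)
               xs ys zs ws us → onHalves⁴ f (xs ++ (ys ++ (zs ++ (ws ++ us)))) ≡ f xs ys zs ws us
onHalves⁴-++ f xs ys zs ws us =
  trans (onHalves-++ (λ x → onHalves³ (f x)) xs (ys ++ (zs ++ (ws ++ us)))) (onHalves³-++ (f xs) ys zs ws us)

bitsAt : ∀ {A : Set} {n m} → Vec A n → (Fin m → Fin n) → Vec A m
bitsAt v ws = tabulate (lookup v ∘ ws)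

-- A template describes an input tape: each cell holds a fixed symbol or the bit on an input wire.
instantiate : ∀ {k} → Vec Bool k → Sym ⊎ Fin k → Sym
instantiate v (inj₁ s) = s
instantiate v (inj₂ j) = encBit (lookup v j)

templateAt : ∀ {k n} → Vec (Sym ⊎ Fin k) n → ℕ → Sym ⊎ Fin k
templateAt []          j       = inj₁ blank
templateAt (e ∷ _)     zero    = e
templateAt (_ ∷ tpl)   (suc j) = templateAt tpl j

cellAt-instantiate : ∀ {k n} (v : Vec Bool k) (tpl : Vec (Sym ⊎ Fin k) n) j →
                     cellAt (toList (map (instantiate v) tpl)) j ≡ instantiate v (templateAt tpl j)
cellAt-instantiate v []        j       = refl
cellAt-instantiate v (e ∷ tpl) zero    = refl
cellAt-instantiate v (e ∷ tpl) (suc j) = cellAt-instantiate v tpl j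

realize-symbol : ∀ {k} (e : Sym ⊎ Fin k) → Realizable (suc k) 2 (λ av → encodeSym (instantiate (V.tail av) e)) 4
realize-symbol (inj₁ s) = realize-constVec (encodeSym s)
realize-symbol (inj₂ j) = realize-resp (λ { (_ ∷ v) → sym (encodeSym-encBit (lookup v j)) }) (s≤s (s≤s z≤n))
  (realize-++ (realize-const true) (realize-select {1} (λ _ → suc j)))

module Encoded (M : TM) where
  open Windowed M

  stateBits : ℕ
  stateBits = suc (TM.Q M)

  width : ℕ → ℕ
  width K = suc (stateBits + (2 + (K * 2 + K * 2)))

  -- The leading bit is carried along unchanged: it is the dummy wire of the gadgets.
  encodeSnapshot : ∀ {K} → Bool → Snapshot K → Vec Bool (width K)
  encodeSnapshot a (snapshot q h L R) = a ∷ (encodeState q ++ (encodeSym h ++ (encodeTape L ++ encodeTape R)))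

  headFields cellFields : ℕ
  headFields = stateBits + (2 + (2 + 2))
  cellFields = stateBits + (2 + (2 + (2 + 2)))

  headRule : State → Sym → Sym → Sym → State × Sym
  headRule q h = headUpdate (halted q) (δ q h) q h

  leftRule rightRule : Bool → State → Sym → Sym → Sym → Sym → Sym
  leftRule  z q h = leftUpdate  (halted q) (δ q h) z
  rightRule z q h = rightUpdate (halted q) (δ q h) z

  module _ {K : ℕ} where

    stateWire : Fin stateBits → Fin (width K)
    stateWire t = suc (t ↑ˡ (2 + (K * 2 + K * 2)))

    headWire : Fin 2 → Fin (width K)
    headWire b = suc (stateBits ↑ʳ (b ↑ˡ (K * 2 + K * 2)))

    leftWire rightWire : Fin K → Fin 2 → Fin (width K)
    leftWire  i b = suc (stateBits ↑ʳ (2 ↑ʳ (F.combine i b ↑ˡ (K * 2))))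
    rightWire i b = suc (stateBits ↑ʳ (2 ↑ʳ ((K * 2) ↑ʳ F.combine i b)))

    tapeAt : (Fin K → Fin 2 → Fin (width K)) → Vec Bool (width K) → Vec Sym K
    tapeAt side v = tabulate (λ i → decodeSym (bitsAt v (side i)))

    decodeSnapshot : Vec Bool (width K) → Snapshot K
    decodeSnapshot v = snapshot (decodeState (bitsAt v stateWire)) (decodeSym (bitsAt v headWire))
                                (tapeAt leftWire v) (tapeAt rightWire v)

    module _ (a : Bool) (q : State) (h : Sym) (L R : Vec Sym K) where
      private
        v = encodeSnapshot a (snapshot q h L R)

      lookup-stateWire : ∀ t → lookup v (stateWire t) ≡ lookup (encodeState q) t
      lookup-stateWire t = lookup-++ˡ (encodeState q) _ t

      lookup-headWire : ∀ b → lookup v (headWire b) ≡ lookup (encodeSym h) b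
      lookup-headWire b = trans (lookup-++ʳ (encodeState q) _ _) (lookup-++ˡ (encodeSym h) _ b)

      lookup-leftWire : ∀ i b → lookup v (leftWire i b) ≡ lookup (encodeSym (lookup L i)) b
      lookup-leftWire i b = trans (lookup-++ʳ (encodeState q) _ _) (trans (lookup-++ʳ (encodeSym h) _ _)
        (trans (lookup-++ˡ (encodeTape L) (encodeTape R) _) (lookup-encodeTape L i b)))

      lookup-rightWire : ∀ i b → lookup v (rightWire i b) ≡ lookup (encodeSym (lookup R i)) b
      lookup-rightWire i b = trans (lookup-++ʳ (encodeState q) _ _) (trans (lookup-++ʳ (encodeSym h) _ _)
        (trans (lookup-++ʳ (encodeTape L) (encodeTape R) _) (lookup-encodeTape R i b)))

    tapeAt-encoded : ∀ side (v : Vec Bool (width K)) (S : Vec Sym K) →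
                     (∀ i b → lookup v (side i b) ≡ lookup (encodeSym (lookup S i)) b) → tapeAt side v ≡ S
    tapeAt-encoded side v S e = trans (tabulate-cong cell) (tabulate∘lookup S)
      where
      cell : ∀ i → decodeSym (bitsAt v (side i)) ≡ lookup S i
      cell i = trans (cong decodeSym (tabulate-lookup-cong v _ (side i) (e i))) (decodeSym-encodeSym (lookup S i))

    decodeSnapshot-encodeSnapshot : ∀ a s → decodeSnapshot (encodeSnapshot a s) ≡ s
    decodeSnapshot-encodeSnapshot a (snapshot q h L R) = cong-snapshot
      (trans (cong decodeState (tabulate-lookup-cong v _ stateWire (lookup-stateWire a q h L R))) (decodeState-encodeState q))
      (trans (cong decodeSym (tabulate-lookup-cong v _ headWire (lookup-headWire a q h L R))) (decodeSym-encodeSym h))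
      (tapeAt-encoded leftWire v L (lookup-leftWire a q h L R))
      (tapeAt-encoded rightWire v R (lookup-rightWire a q h L R))
      where
      v = encodeSnapshot a (snapshot q h L R)

    -- A neighbour outside the window reads the head wires as a placeholder and decodes as blank.
    neighbourWire : (Fin K → Fin 2 → Fin (width K)) → Maybe (Fin K) → Fin 2 → Fin (width K)
    neighbourWire side (just i) = side i
    neighbourWire side nothing  = headWire

    decodeNeighbour : Maybe (Fin K) → Vec Bool 2 → Sym
    decodeNeighbour (just _) w = decodeSym w
    decodeNeighbour nothing  _ = blank

    decodeNeighbour-correct : ∀ side v j →
      decodeNeighbour (cellIndex K j) (bitsAt v (neighbourWire side (cellIndex K j))) ≡ windowCellAt (tapeAt side v) j
    decodeNeighbour-correct side v j = trans (byIndex (cellIndex K j)) (sym (windowCellAt-cellIndex (tapeAt side v) j))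
      where
      byIndex : ∀ m → decodeNeighbour m (bitsAt v (neighbourWire side m)) ≡ maybe (lookup (tapeAt side v)) blank m
      byIndex (just i) = sym (lookup∘tabulate _ i)
      byIndex nothing  = refl

    headInputs : Vec Bool (width K) → Vec Bool headFields
    headInputs v = bitsAt v stateWire ++ (bitsAt v headWire ++
                     (bitsAt v (neighbourWire leftWire (cellIndex K 0)) ++ bitsAt v (neighbourWire rightWire (cellIndex K 0))))

    realize-headInputs : Realizable (width K) headFields headInputs 0
    realize-headInputs = realize-++ (realize-select stateWire) (realize-++ (realize-select headWire)
      (realize-++ (realize-select (neighbourWire leftWire (cellIndex K 0))) (realize-select (neighbourWire rightWire (cellIndex K 0)))))

    headFromFields : Vec Bool stateBits → Vec Bool 2 → Vec Bool 2 → Vec Bool 2 → State × Sym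
    headFromFields qs hs ls rs =
      headRule (decodeState qs) (decodeSym hs) (decodeNeighbour (cellIndex K 0) ls) (decodeNeighbour (cellIndex K 0) rs)

    decodeHeadInputs-correct : ∀ v → let s = decodeSnapshot v in
      onHalves³ headFromFields (headInputs v)
        ≡ headRule (Snapshot.state s) (Snapshot.head s) (windowCellAt (Snapshot.lefts s) 0) (windowCellAt (Snapshot.rights s) 0)
    decodeHeadInputs-correct v =
      trans (onHalves³-++ headFromFields (bitsAt v stateWire) (bitsAt v headWire)
                          (bitsAt v (neighbourWire leftWire (cellIndex K 0))) (bitsAt v (neighbourWire rightWire (cellIndex K 0))))
            (cong₂ (headRule _ _) (decodeNeighbour-correct leftWire v 0) (decodeNeighbour-correct rightWire v 0))

    cellInputs : (Fin K → Fin 2 → Fin (width K)) → Fin K → Vec Bool (width K) →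
                 Vec Bool cellFields
    cellInputs side i v = bitsAt v stateWire ++ (bitsAt v headWire ++
      (bitsAt v (neighbourWire side (cellIndex K (pred (toℕ i)))) ++
        (bitsAt v (side i) ++ bitsAt v (neighbourWire side (cellIndex K (suc (toℕ i)))))))

    realize-cellInputs : ∀ side i → Realizable (width K) cellFields (cellInputs side i) 0
    realize-cellInputs side i = realize-++ (realize-select stateWire) (realize-++ (realize-select headWire)
      (realize-++ (realize-select (neighbourWire side (cellIndex K (pred (toℕ i)))))
        (realize-++ (realize-select (side i)) (realize-select (neighbourWire side (cellIndex K (suc (toℕ i))))))))

    cellFromFields : (Bool → State → Sym → Sym → Sym → Sym → Sym) → Fin K →
                     Vec Bool stateBits → Vec Bool 2 → Vec Bool 2 → Vec Bool 2 → Vec Bool 2 → Sym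
    cellFromFields rule i qs hs xs ys us =
      rule (nextToHead i) (decodeState qs) (decodeSym hs)
           (decodeNeighbour (cellIndex K (pred (toℕ i))) xs) (decodeSym ys) (decodeNeighbour (cellIndex K (suc (toℕ i))) us)

    cellFromFields-correct : ∀ rule side i v → let s = decodeSnapshot v in
      onHalves⁴ (cellFromFields rule i) (cellInputs side i v)
        ≡ updateCell (λ z → rule z (Snapshot.state s) (Snapshot.head s)) (tapeAt side v) i
    cellFromFields-correct rule side i v =
      trans (onHalves⁴-++ (cellFromFields rule i) (bitsAt v stateWire) (bitsAt v headWire)
                          (bitsAt v (neighbourWire side (cellIndex K (pred (toℕ i))))) (bitsAt v (side i))
                          (bitsAt v (neighbourWire side (cellIndex K (suc (toℕ i))))))
            (cong₃ (rule (nextToHead i) _ _) (decodeNeighbour-correct side v (pred (toℕ i)))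
                   (sym (lookup∘tabulate _ i)) (decodeNeighbour-correct side v (suc (toℕ i))))

    stepBits : Vec Bool (width K) → Vec Bool (width K)
    stepBits v = encodeSnapshot (V.head v) (snapStep (decodeSnapshot v))

    stepCost : ℕ
    stepCost = stateBits * truthTableSize headFields + (2 * truthTableSize headFields
               + (K * (2 * truthTableSize cellFields) + K * (2 * truthTableSize cellFields)))

    newTape : (Bool → State → Sym → Sym → Sym → Sym → Sym) → (Fin K → Fin 2 → Fin (width K)) →
              Vec Bool (width K) → Vec Bool (K * 2)
    newTape rule side v = V.concat (tabulate (λ i → encodeSym (onHalves⁴ (cellFromFields rule i) (cellInputs side i v))))

    realize-tapeStep : ∀ side rule → Realizable (width K) (K * 2) (newTape rule side) (K * (2 * truthTableSize cellFields))
    realize-tapeStep side rule = realize-concat K _ λ i →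
      realize-local (realize-cellInputs side i) (encodeSym ∘ onHalves⁴ (cellFromFields rule i))

    realize-step : Realizable (width K) (width K) stepBits stepCost
    realize-step = realize-resp stepped ≤-refl
      (realize-++ (realize-select {1} (λ _ → zero))
        (realize-++ (realize-local realize-headInputs (encodeState ∘ proj₁ ∘ onHalves³ headFromFields))
          (realize-++ (realize-local realize-headInputs (encodeSym ∘ proj₂ ∘ onHalves³ headFromFields))
            (realize-++ (realize-tapeStep leftWire leftRule) (realize-tapeStep rightWire rightRule)))))
      where
      tape≡ : ∀ rule side v → let s = decodeSnapshot v in
        newTape rule side v ≡ encodeTape (tabulate (updateCell (λ z → rule z (Snapshot.state s) (Snapshot.head s)) (tapeAt side v)))
      tape≡ rule side v = cong V.concat (trans (tabulate-cong (λ i → cong encodeSym (cellFromFields-correct rule side i v)))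
                                               (tabulate-∘ encodeSym _))
      stepped : ∀ v → let h = onHalves³ headFromFields (headInputs v) in
        lookup v zero ∷ (encodeState (proj₁ h) ++ (encodeSym (proj₂ h) ++ (newTape leftRule leftWire v ++ newTape rightRule rightWire v)))
          ≡ stepBits v
      stepped v@(a ∷ _) = cong (a ∷_)
        (cong₂ _++_ (cong (encodeState ∘ proj₁) (decodeHeadInputs-correct v))
          (cong₂ _++_ (cong (encodeSym ∘ proj₂) (decodeHeadInputs-correct v))
            (cong₂ _++_ (tape≡ leftRule leftWire v) (tape≡ rightRule rightWire v))))

    iterate-stepBits : ∀ t a (s : Snapshot K) → iterate t stepBits (encodeSnapshot a s) ≡ encodeSnapshot a (snapRun t s)
    iterate-stepBits zero    a s = refl
    iterate-stepBits (suc t) a s =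
      trans (cong (iterate t stepBits ∘ encodeSnapshot a ∘ snapStep) (decodeSnapshot-encodeSnapshot a s))
            (iterate-stepBits t a (snapStep s))

    initialSnapshot : ∀ {k n} → Vec (Sym ⊎ Fin k) n → Vec Bool k → Snapshot K
    initialSnapshot tpl v = snapshot zero (instantiate v (templateAt tpl 0)) (window K [])
                                     (tabulate (λ i → instantiate v (templateAt tpl (suc (toℕ i)))))

    initialSnapshot≡snapshotOf : ∀ {k n} (tpl : Vec (Sym ⊎ Fin k) n) v →
      initialSnapshot tpl v ≡ snapshotOf K (initConfig M (toList (map (instantiate v) tpl)))
    initialSnapshot≡snapshotOf tpl v = trans
      (cong-snapshot refl (sym (cellAt-instantiate v tpl 0)) refl
                     (tabulate-cong (λ i → sym (cellAt-instantiate v tpl (suc (toℕ i))))))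
      (snapshotOf-init (toList (map (instantiate v) tpl)))
      where
      snapshotOf-init : ∀ inp → snapshot zero (cellAt inp 0) (window K []) (tabulate (λ i → cellAt inp (suc (toℕ i))))
                                ≡ snapshotOf K (initConfig M inp)
      snapshotOf-init []      = refl
      snapshotOf-init (_ ∷ _) = refl

    initCost : ℕ
    initCost = stateBits * 2 + (4 + (K * 4 + K * 4))

    realize-init : ∀ {k n} (tpl : Vec (Sym ⊎ Fin k) n) →
                   Realizable (suc k) (width K) (λ av → encodeSnapshot (V.head av) (initialSnapshot tpl (V.tail av))) initCost
    realize-init tpl = realize-resp initial ≤-refl
      (realize-++ (realize-select {1} (λ _ → zero))
        (realize-++ (realize-constVec (encodeState zero))
          (realize-++ (realize-symbol (templateAt tpl 0))
            (realize-++ (realize-concat K _ (λ _ → realize-symbol (inj₁ blank)))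
                        (realize-concat K _ (λ i → realize-symbol (templateAt tpl (suc (toℕ i)))))))))
      where
      initial : ∀ av →
        lookup av zero ∷ (encodeState zero ++ (encodeSym (instantiate (V.tail av) (templateAt tpl 0)) ++
          (V.concat (tabulate (λ (_ : Fin K) → encodeSym blank)) ++
           V.concat (tabulate (λ (i : Fin K) → encodeSym (instantiate (V.tail av) (templateAt tpl (suc (toℕ i)))))))))
        ≡ encodeSnapshot (V.head av) (initialSnapshot tpl (V.tail av))
      initial (a ∷ v) = cong (λ w → a ∷ (encodeState zero ++ (encodeSym (instantiate v (templateAt tpl 0)) ++ w)))
        (cong₂ _++_ (cong V.concat (tabulate-∘ encodeSym (λ (_ : Fin K) → blank)))
                    (cong V.concat (tabulate-∘ encodeSym (λ (i : Fin K) → instantiate v (templateAt tpl (suc (toℕ i)))))))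

    outputWire : ℕ → Fin (width K)
    outputWire zero    = headWire (suc zero)
    outputWire (suc j) = neighbourWire rightWire (cellIndex K j) (suc zero)

    lookup-outputWire : ∀ a (s : Snapshot K) j b → outputCellAt s j ≡ encBit b → lookup (encodeSnapshot a s) (outputWire j) ≡ b
    lookup-outputWire a (snapshot q h L R) zero b h≡ =
      trans (lookup-headWire a q h L R (suc zero)) (lookup-encodeSym-encBit h≡)
    lookup-outputWire a (snapshot q h L R) (suc j) b c≡ = byIndex (cellIndex K j) (trans (sym (windowCellAt-cellIndex R j)) c≡)
      where
      byIndex : ∀ m → maybe (lookup R) blank m ≡ encBit b →
                lookup (encodeSnapshot a (snapshot q h L R)) (neighbourWire rightWire m (suc zero)) ≡ b
      byIndex (just i) e = trans (lookup-rightWire a q h L R i (suc zero)) (lookup-encodeSym-encBit e)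
      byIndex nothing e = ⊥-elim (blank≢encBit b e)
        where
        blank≢encBit : ∀ b → blank ≢ encBit b
        blank≢encBit false ()
        blank≢encBit true  ()

  simulationCost : ℕ → ℕ → ℕ
  simulationCost K T = initCost {K} + T * stepCost {K}

  -- A T-step run on an input of length n never leaves a window of width n + T.
  realize-simulation : ∀ {k O} T {n} (tpl : Vec (Sym ⊎ Fin k) n) (g : Vec Bool k → Vec Bool O) →
    (∀ v → ComputesWithin M T (toList (map (instantiate v) tpl)) (toList (g v))) →
    Realizable (suc k) O (g ∘ V.tail) (simulationCost (n + T) T)
  realize-simulation {O = O} T {n} tpl g computes = realize-resp correct (≤-reflexive (+-identityʳ _))
    (realize-∘ (realize-∘ (realize-init {K} tpl) (realize-iterate T (realize-step {K})))
               (realize-select (outputWire {K} ∘ toℕ)))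
    where
    K = n + T
    outputBits : Vec Bool (width K) → Vec Bool O
    outputBits w = tabulate (lookup w ∘ outputWire {K} ∘ toℕ)
    correct : ∀ av → outputBits (iterate T (stepBits {K}) (encodeSnapshot (V.head av) (initialSnapshot {K} tpl (V.tail av))))
                     ≡ g (V.tail av)
    correct (a ∷ v) = begin
      outputBits (iterate T (stepBits {K}) (encodeSnapshot a (initialSnapshot {K} tpl v)))
        ≡⟨ cong (outputBits ∘ iterate T (stepBits {K}) ∘ encodeSnapshot a) (initialSnapshot≡snapshotOf {K} tpl v) ⟩
      outputBits (iterate T (stepBits {K}) (encodeSnapshot a s₀))
        ≡⟨ cong outputBits (iterate-stepBits {K} T a s₀) ⟩
      outputBits (encodeSnapshot a (snapRun T s₀))
        ≡⟨ tabulate-lookup-cong (encodeSnapshot a (snapRun T s₀)) (g v) (outputWire {K} ∘ toℕ) (λ j →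
             lookup-outputWire a (snapRun T s₀) (toℕ j) (lookup (g v) j) (snapRun-output K T inp (g v) (computes v) len≤ j)) ⟩
      g v ∎
      where
      open ≡-Reasoning
      inp = toList (map (instantiate v) tpl)
      s₀ = snapshotOf K (initConfig M inp)
      len≤ : length inp + T ≤ K
      len≤ = ≤-reflexive (cong (_+ T) (length-toList (map (instantiate v) tpl)))

  PowerBounded-simulationCost : ∀ {K T} → PowerBounded K → PowerBounded T →
                                PowerBounded (λ n → simulationCost (K n) (T n))
  PowerBounded-simulationCost {K} bK bT = PowerBounded-+ (affine (stateBits * 2) 4 4)
    (PowerBounded-* bT (affine (stateBits * truthTableSize headFields) (2 * truthTableSize headFields)
                               (2 * truthTableSize cellFields)))
    where
    affine : ∀ a b c → PowerBounded (λ n → a + (b + (K n * c + K n * c)))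
    affine a b c = PowerBounded-+ (PowerBounded-const a) (PowerBounded-+ (PowerBounded-const b)
      (PowerBounded-+ (PowerBounded-* bK (PowerBounded-const c)) (PowerBounded-* bK (PowerBounded-const c))))

encode-toList : ∀ {n} (z : Vec Bool n) → encode (toList z) ≡ toList (map encBit z)
encode-toList []      = refl
encode-toList (b ∷ z) = cong (encBit b ∷_) (encode-toList z)

bitsTemplate : ∀ {k m} → (Fin m → Fin k) → Vec (Sym ⊎ Fin k) m
bitsTemplate τ = tabulate (inj₂ ∘ τ)

instantiate-bitsTemplate : ∀ {k m} (w : Vec Bool k) (τ : Fin m → Fin k) →
                           toList (map (instantiate w) (bitsTemplate τ)) ≡ encode (toList (bitsAt w τ))
instantiate-bitsTemplate w τ = begin
  toList (map (instantiate w) (tabulate (inj₂ ∘ τ))) ≡⟨ cong toList (tabulate-∘ (instantiate w) (inj₂ ∘ τ)) ⟨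
  toList (tabulate (encBit ∘ lookup w ∘ τ))           ≡⟨ cong toList (tabulate-∘ encBit (lookup w ∘ τ)) ⟩
  toList (map encBit (bitsAt w τ))                    ≡⟨ encode-toList (bitsAt w τ) ⟨
  encode (toList (bitsAt w τ))                        ∎
  where open ≡-Reasoning

take≡bitsAt : ∀ m {n} (w : Vec Bool (m + n)) → take m w ≡ bitsAt w (_↑ˡ n)
take≡bitsAt m w = sym (tabulate-lookup-cong w (take m w) (_↑ˡ _) λ i →
  trans (cong (λ u → lookup u (i ↑ˡ _)) (sym (take++drop≡id m w))) (lookup-++ˡ (take m w) (drop m w) i))

drop≡bitsAt : ∀ m {n} (w : Vec Bool (m + n)) → drop m w ≡ bitsAt w (m ↑ʳ_)
drop≡bitsAt m w = sym (tabulate-lookup-cong w (drop m w) (m ↑ʳ_) λ i →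
  trans (cong (λ u → lookup u (m ↑ʳ i)) (sym (take++drop≡id m w))) (lookup-++ʳ (take m w) (drop m w) i))

pairTemplate : ∀ N R → Vec (Sym ⊎ Fin (N + R)) (N + suc R)
pairTemplate N R = bitsTemplate (_↑ˡ R) ++ (inj₁ sep ∷ bitsTemplate (N ↑ʳ_))

instantiate-pairTemplate : ∀ N R (w : Vec Bool (N + R)) →
  toList (map (instantiate w) (pairTemplate N R)) ≡ encode₂ (toList (take N w)) (toList (drop N w))
instantiate-pairTemplate N R w = begin
  toList (map (instantiate w) (pairTemplate N R))
    ≡⟨ cong toList (map-++ (instantiate w) (bitsTemplate (_↑ˡ R)) _) ⟩
  toList (map (instantiate w) (bitsTemplate (_↑ˡ R)) ++ (sep ∷ map (instantiate w) (bitsTemplate (N ↑ʳ_))))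
    ≡⟨ toList-++ (map (instantiate w) (bitsTemplate (_↑ˡ R))) _ ⟩
  toList (map (instantiate w) (bitsTemplate (_↑ˡ R))) L.++ (sep ∷ toList (map (instantiate w) (bitsTemplate (N ↑ʳ_))))
    ≡⟨ cong₂ (λ xs ys → xs L.++ (sep ∷ ys)) (instantiate-bitsTemplate w (_↑ˡ R)) (instantiate-bitsTemplate w (N ↑ʳ_)) ⟩
  encode₂ (toList (bitsAt w (_↑ˡ R))) (toList (bitsAt w (N ↑ʳ_)))
    ≡⟨ cong₂ (λ x y → encode₂ (toList x) (toList y)) (take≡bitsAt N w) (drop≡bitsAt N w) ⟨
  encode₂ (toList (take N w)) (toList (drop N w)) ∎
  where open ≡-Reasoning

fromListOfLength : ∀ {A : Set} (l : List A) {k} → length l ≡ k → Vec A k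
fromListOfLength l refl = V.fromList l

toList-fromListOfLength : ∀ {A : Set} (l : List A) {k} (e : length l ≡ k) → toList (fromListOfLength l e) ≡ l
toList-fromListOfLength l refl = toList∘fromList l

ComputesWithin-cong : ∀ {M T T′ inp inp′ out out′} → T ≡ T′ → inp ≡ inp′ → out ≡ out′ →
                      ComputesWithin M T inp out → ComputesWithin M T′ inp′ out′
ComputesWithin-cong refl refl refl c = c

countWhere-cong : ∀ m {P Q : Vec Bool m → Bool} → (∀ r → P r ≡ Q r) → countWhere m P ≡ countWhere m Q
countWhere-cong zero    P≗Q = cong (λ b → if b then 1 else 0) (P≗Q [])
countWhere-cong (suc m) P≗Q = cong₂ _+_ (countWhere-cong m (P≗Q ∘ (false ∷_))) (countWhere-cong m (P≗Q ∘ (true ∷_)))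

LengthRegularReduction : Lang → Lang → Set
LengthRegularReduction L L₁ =
  Σ (List Bool → List Bool) λ f → Σ (ℕ → ℕ) λ m →
    (PolyTimeFn f × (∀ x → length (f x) ≡ m (length x)) × (∀ x → L x ≡ L₁ (f x)))

module Henry {L₁ : Lang} {L₂ : Lang₂} {L : Lang}
  (f : List Bool → List Bool) (m : ℕ → ℕ) (Mf : TM) (pf : ℕ → ℕ) (pf-poly : PolyBounded pf)
  (f-computes : ∀ x → ComputesWithin Mf (pf (length x)) (encode x) (f x))
  (length-f : ∀ x → length (f x) ≡ m (length x)) (f-reduces : ∀ x → L x ≡ L₁ (f x))
  (sh : SplitHide L₁ L₂) (bsm : EfficientBSM L₂) where

  module SH = SplitHide sh
  module BSM = EfficientBSM bsm

  R : ℕ → ℕ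
  R n = SH.ρ (m n)

  inputs : ℕ → ℕ
  inputs n = n + suc (R n)

  length-f-toList : ∀ {n} (z : Vec Bool n) → length (f (toList z)) ≡ m n
  length-f-toList z = trans (length-f (toList z)) (cong m (length-toList z))

  reduce : ∀ n → Vec Bool n → Vec Bool (m n)
  reduce n z = fromListOfLength (f (toList z)) (length-f-toList z)

  toList-reduce : ∀ n z → toList (reduce n z) ≡ f (toList z)
  toList-reduce n z = toList-fromListOfLength (f (toList z)) (length-f-toList z)

  reduce-computes : ∀ n (z : Vec Bool n) →
    ComputesWithin Mf (pf n) (toList (map (instantiate z) (bitsTemplate (λ j → j)))) (toList (reduce n z))
  reduce-computes n z = ComputesWithin-cong (cong pf (length-toList z))
    (trans (cong (encode ∘ toList) (sym (tabulate∘lookup z))) (sym (instantiate-bitsTemplate z (λ j → j))))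
    (sym (toList-reduce n z)) (f-computes (toList z))

  reductionCost : ℕ → ℕ
  reductionCost n = Encoded.simulationCost Mf (n + pf n) (pf n)

  m≤ : ∀ n → m n ≤ suc (n + pf n)
  m≤ n = begin
    m n                                          ≡⟨ length-toList (reduce n z) ⟨
    length (toList (reduce n z))                 ≤⟨ Windowed.length-output≤ Mf (pf n) _ _ (reduce-computes n z) ⟩
    suc (length (toList (map (instantiate z) (bitsTemplate (λ j → j)))) + pf n)
                                                 ≡⟨ cong (λ k → suc (k + pf n)) (length-toList (map (instantiate z) (bitsTemplate (λ j → j)))) ⟩
    suc (n + pf n)                               ∎
    where
    open ≤-Reasoning
    z = V.replicate n false

  -- Henry's input is z ++ (e ∷ r) with r the randomness of the split-hide reduction; the
  -- extra random bit e is the dummy wire of the simulation gadgets (z may be empty).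
  prepare : ∀ n → Vec Bool (inputs n) → Vec Bool (suc (m n + R n))
  prepare n v = lookup v (n ↑ʳ zero) ∷ (reduce n (bitsAt v (_↑ˡ suc (R n))) ++ bitsAt v (λ j → n ↑ʳ suc j))

  realize-prepare : ∀ n → Realizable (inputs n) (suc (m n + R n)) (prepare n) (reductionCost n)
  realize-prepare n = realize-resp (λ _ → refl) (≤-reflexive (+-identityʳ (reductionCost n)))
    (realize-++ (realize-select {1} (λ _ → n ↑ʳ zero))
      (realize-++ (realize-∘ (realize-select withDummy)
                             (Encoded.realize-simulation Mf (pf n) (bitsTemplate (λ j → j)) (reduce n) (reduce-computes n)))
                  (realize-select (λ j → n ↑ʳ suc j))))
    where
    withDummy : Fin (suc n) → Fin (inputs n)
    withDummy zero    = n ↑ʳ zero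
    withDummy (suc j) = j ↑ˡ suc (R n)

  prepare-++ : ∀ n (z : Vec Bool n) e r → prepare n (z ++ (e ∷ r)) ≡ e ∷ (reduce n z ++ r)
  prepare-++ n z e r = cong₂ _∷_ (lookup-++ʳ z (e ∷ r) zero)
    (cong₂ _++_ (cong (reduce n) (tabulate-lookup-cong (z ++ (e ∷ r)) z (_↑ˡ suc (R n)) (lookup-++ˡ z (e ∷ r))))
                (tabulate-lookup-cong (z ++ (e ∷ r)) r (λ j → n ↑ʳ suc j) (λ j → lookup-++ʳ z (e ∷ r) (suc j))))

  pf-bounded : PowerBounded pf
  pf-bounded = PolyBounded⇒PowerBounded pf-poly

  m-bounded : PowerBounded m
  m-bounded = PowerBounded-mono m≤ (PowerBounded-+ (PowerBounded-const 1) (PowerBounded-+ PowerBounded-id pf-bounded))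

  ρ-bounded : PowerBounded SH.ρ
  ρ-bounded = PolyBounded⇒PowerBounded SH.ρ-poly

  inputs-bounded : PowerBounded inputs
  inputs-bounded = PowerBounded-+ PowerBounded-id (PowerBounded-+ (PowerBounded-const 1) (PowerBounded-∘ ρ-bounded m-bounded))

  reductionCost-bounded : PowerBounded reductionCost
  reductionCost-bounded = Encoded.PowerBounded-simulationCost Mf (PowerBounded-+ PowerBounded-id pf-bounded) pf-bounded

  module Query (ℓ : ℕ → ℕ) (g : ∀ N → Vec Bool N → Vec Bool (SH.ρ N) → Vec Bool (ℓ N))
    (g-poly : ∃[ M ] ∃[ p ] (PolyBounded p ×
                (∀ N x r → ComputesWithin M (p N) (encode₂ (toList x) (toList r)) (toList (g N x r)))))
    (g-hides : ∀ N (x x′ : Vec Bool N) (y : Vec Bool (ℓ N)) →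
                 countWhere (SH.ρ N) (λ r → eqBits (g N x r) y) ≡ countWhere (SH.ρ N) (λ r → eqBits (g N x′ r) y))
    where

    Mg : TM
    Mg = proj₁ g-poly

    pg : ℕ → ℕ
    pg = proj₁ (proj₂ g-poly)

    pairFn : ∀ N → Vec Bool (N + SH.ρ N) → Vec Bool (ℓ N)
    pairFn N w = g N (take N w) (drop N w)

    pair-computes : ∀ N w →
      ComputesWithin Mg (pg N) (toList (map (instantiate w) (pairTemplate N (SH.ρ N)))) (toList (pairFn N w))
    pair-computes N w = ComputesWithin-cong refl (sym (instantiate-pairTemplate N (SH.ρ N) w)) refl
                                            (proj₂ (proj₂ (proj₂ g-poly)) N (take N w) (drop N w))

    ℓ≤ : ∀ N → ℓ N ≤ suc ((N + suc (SH.ρ N)) + pg N)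
    ℓ≤ N = begin
      ℓ N                                        ≡⟨ length-toList (pairFn N w) ⟨
      length (toList (pairFn N w))               ≤⟨ Windowed.length-output≤ Mg (pg N) _ _ (pair-computes N w) ⟩
      suc (length (toList (map (instantiate w) (pairTemplate N (SH.ρ N)))) + pg N)
        ≡⟨ cong (λ k → suc (k + pg N)) (length-toList (map (instantiate w) (pairTemplate N (SH.ρ N)))) ⟩
      suc ((N + suc (SH.ρ N)) + pg N)            ∎
      where
      open ≤-Reasoning
      w = V.replicate (N + SH.ρ N) false

    queryCost : ℕ → ℕ
    queryCost n = reductionCost n + Encoded.simulationCost Mg ((m n + suc (R n)) + pg (m n)) (pg (m n))

    query : ∀ n → Σ (Circuit (inputs n) (ℓ (m n))) λ C →
              (∀ x → evalC C x ≡ pairFn (m n) (V.tail (prepare n x))) × size C ≤ inputs n + queryCost n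
    query n = circuitFor (realize-∘ (realize-prepare n)
      (Encoded.realize-simulation Mg (pg (m n)) (pairTemplate (m n) (R n)) (pairFn (m n)) (pair-computes (m n))))

    queryCircuit : ∀ n → Circuit (inputs n) (ℓ (m n))
    queryCircuit n = proj₁ (query n)

    query-correct : ∀ n z e r → evalC (queryCircuit n) (z ++ (e ∷ r)) ≡ g (m n) (reduce n z) r
    query-correct n z e r = begin
      evalC (queryCircuit n) (z ++ (e ∷ r))             ≡⟨ proj₁ (proj₂ (query n)) (z ++ (e ∷ r)) ⟩
      pairFn (m n) (V.tail (prepare n (z ++ (e ∷ r)))) ≡⟨ cong (pairFn (m n) ∘ V.tail) (prepare-++ n z e r) ⟩
      pairFn (m n) (reduce n z ++ r)                   ≡⟨ cong₂ (g (m n)) (take-++ (reduce n z) r) (drop-++ (reduce n z) r) ⟩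
      g (m n) (reduce n z) r                           ∎
      where open ≡-Reasoning

    query-hides : ∀ n (z z′ : Vec Bool n) (y : Vec Bool (ℓ (m n))) →
      countWhere (suc (R n)) (λ r → eqBits (evalC (queryCircuit n) (z ++ r)) y)
        ≡ countWhere (suc (R n)) (λ r → eqBits (evalC (queryCircuit n) (z′ ++ r)) y)
    query-hides n z z′ y = cong₂ _+_ (for false) (for true)
      where
      open ≡-Reasoning
      for : ∀ e → countWhere (R n) (λ r → eqBits (evalC (queryCircuit n) (z ++ (e ∷ r))) y)
                ≡ countWhere (R n) (λ r → eqBits (evalC (queryCircuit n) (z′ ++ (e ∷ r))) y)
      for e = begin
        countWhere (R n) (λ r → eqBits (evalC (queryCircuit n) (z ++ (e ∷ r))) y)
          ≡⟨ countWhere-cong (R n) (λ r → cong (λ w → eqBits w y) (query-correct n z e r)) ⟩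
        countWhere (R n) (λ r → eqBits (g (m n) (reduce n z) r) y)
          ≡⟨ g-hides (m n) (reduce n z) (reduce n z′) y ⟩
        countWhere (R n) (λ r → eqBits (g (m n) (reduce n z′) r) y)
          ≡⟨ countWhere-cong (R n) (λ r → cong (λ w → eqBits w y) (query-correct n z′ e r)) ⟨
        countWhere (R n) (λ r → eqBits (evalC (queryCircuit n) (z′ ++ (e ∷ r))) y) ∎

    pg-bounded : PowerBounded pg
    pg-bounded = PolyBounded⇒PowerBounded (proj₁ (proj₂ (proj₂ g-poly)))

    ℓ-bounded : PowerBounded ℓ
    ℓ-bounded = PowerBounded-mono ℓ≤ (PowerBounded-+ (PowerBounded-const 1)
      (PowerBounded-+ (PowerBounded-+ PowerBounded-id (PowerBounded-+ (PowerBounded-const 1) ρ-bounded)) pg-bounded))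

    queryCost-bounded : PowerBounded queryCost
    queryCost-bounded = PowerBounded-+ reductionCost-bounded (Encoded.PowerBounded-simulationCost Mg
      (PowerBounded-∘ (PowerBounded-+ (PowerBounded-+ PowerBounded-id (PowerBounded-+ (PowerBounded-const 1) ρ-bounded)) pg-bounded)
                      m-bounded)
      (PowerBounded-∘ pg-bounded m-bounded))

  module QA = Query SH.ℓa SH.a SH.a-poly SH.a-hide
  module QB = Query SH.ℓb SH.b SH.b-poly SH.b-hide

  ℓA ℓB : ℕ → ℕ
  ℓA n = BSM.ℓA (SH.ℓa (m n)) (SH.ℓb (m n))
  ℓB n = BSM.ℓB (SH.ℓa (m n)) (SH.ℓb (m n))

  carol : ∀ n → Circuit (ℓA n + ℓB n) 1
  carol n = BSM.C (SH.ℓa (m n)) (SH.ℓb (m n))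

  decision : ∀ n → Σ (Circuit (inputs n + (ℓA n + ℓB n)) 1) λ C →
               (∀ x → evalC C x ≡ evalC (carol n) (bitsAt x (inputs n ↑ʳ_)))
               × size C ≤ (inputs n + (ℓA n + ℓB n)) + Circuit.g (carol n)
  decision n = circuitFor (realize-∘ (realize-select (inputs n ↑ʳ_)) (realize-circuit (carol n)))

  decisionCircuit : ∀ n → Circuit (inputs n + (ℓA n + ℓB n)) 1
  decisionCircuit n = proj₁ (decision n)

  decision-correct : ∀ n (u : Vec Bool (inputs n)) (answers : Vec Bool (ℓA n + ℓB n)) → evalC (decisionCircuit n) (u ++ answers) ≡ evalC (carol n) answers
  decision-correct n u answers = trans (proj₁ (proj₂ (decision n)) (u ++ answers))
    (cong (evalC (carol n)) (tabulate-lookup-cong (u ++ answers) answers (inputs n ↑ʳ_) (lookup-++ʳ u answers)))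

  pC : ℕ → ℕ
  pC = proj₁ BSM.efficient

  decision-size : ∀ n → size (decisionCircuit n) ≤ inputs n + pC (SH.ℓa (m n) + SH.ℓb (m n))
  decision-size n = ≤-trans (proj₂ (proj₂ (decision n))) (≤-trans (≤-reflexive (+-assoc (inputs n) _ _))
    (+-monoʳ-≤ (inputs n) (proj₂ (proj₂ BSM.efficient) (SH.ℓa (m n)) (SH.ℓb (m n)))))

  correct : ∀ n (z : Vec Bool n) (r : Vec Bool (suc (R n))) →
    evalC (decisionCircuit n) ((z ++ r) ++ (BSM.A _ _ (evalC (QA.queryCircuit n) (z ++ r))
                                            ++ BSM.B _ _ (evalC (QB.queryCircuit n) (z ++ r))))
      ≡ L (toList z) ∷ []
  correct n z (e ∷ r) = begin
    evalC (decisionCircuit n) ((z ++ (e ∷ r)) ++ (BSM.A _ _ qa ++ BSM.B _ _ qb))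
      ≡⟨ decision-correct n (z ++ (e ∷ r)) (BSM.A _ _ qa ++ BSM.B _ _ qb) ⟩
    evalC (carol n) (BSM.A _ _ qa ++ BSM.B _ _ qb)
      ≡⟨ BSM.correct _ _ qa qb ⟩
    L₂ (toList qa) (toList qb) ∷ []
      ≡⟨ cong₂ (λ u v → L₂ (toList u) (toList v) ∷ []) (QA.query-correct n z e r) (QB.query-correct n z e r) ⟩
    L₂ (toList (SH.a (m n) x r)) (toList (SH.b (m n) x r)) ∷ []
      ≡⟨ cong (_∷ []) (SH.correct (m n) x r) ⟨
    L₁ (toList x) ∷ []
      ≡⟨ cong (λ y → L₁ y ∷ []) (toList-reduce n z) ⟩
    L₁ (f (toList z)) ∷ []
      ≡⟨ cong (_∷ []) (f-reduces (toList z)) ⟨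
    L (toList z) ∷ [] ∎
    where
    open ≡-Reasoning
    qa = evalC (QA.queryCircuit n) (z ++ (e ∷ r))
    qb = evalC (QB.queryCircuit n) (z ++ (e ∷ r))
    x = reduce n z

  sizeBound : ℕ → ℕ
  sizeBound n = (inputs n + QA.queryCost n) + (inputs n + QB.queryCost n) + (inputs n + pC (SH.ℓa (m n) + SH.ℓb (m n)))

  sizeBound-bounded : PowerBounded sizeBound
  sizeBound-bounded = PowerBounded-+
    (PowerBounded-+ (PowerBounded-+ inputs-bounded QA.queryCost-bounded) (PowerBounded-+ inputs-bounded QB.queryCost-bounded))
    (PowerBounded-+ inputs-bounded (PowerBounded-∘ (PolyBounded⇒PowerBounded (proj₁ (proj₂ BSM.efficient)))
                                                   (PowerBounded-+ (PowerBounded-∘ QA.ℓ-bounded m-bounded)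
                                                                   (PowerBounded-∘ QB.ℓ-bounded m-bounded))))

  scheme : EfficientIH2 L
  scheme = record
    { ρ = λ n → suc (R n) ; m₁ = SH.ℓa ∘ m ; m₂ = SH.ℓb ∘ m ; k₁ = ℓA ; k₂ = ℓB
    ; Q₁ = QA.queryCircuit ; Q₂ = QB.queryCircuit ; D = decisionCircuit
    ; O₁ = λ n → BSM.A (SH.ℓa (m n)) (SH.ℓb (m n)) ; O₂ = λ n → BSM.B (SH.ℓa (m n)) (SH.ℓb (m n))
    ; correct = correct ; hide₁ = QA.query-hides ; hide₂ = QB.query-hides
    ; efficient = sizeBound , PowerBounded⇒PolyBounded sizeBound-bounded ,
                  λ n → +-mono-≤ (+-mono-≤ (proj₂ (proj₂ (QA.query n))) (proj₂ (proj₂ (QB.query n)))) (decision-size n) }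

instanceHiding : ∀ {L₁ L₂ L} → LengthRegularReduction L L₁ → SplitHide L₁ L₂ → EfficientBSM L₂ → EfficientIH2 L
instanceHiding (f , m , (Mf , pf , pf-poly , f-computes) , length-f , f-reduces) sh bsm =
  Henry.scheme f m Mf pf pf-poly f-computes length-f f-reduces sh bsm

corollary2p9 : (L₁ : Lang) (L₂ : Lang₂) → NPHard L₁ → SplitHide L₁ L₂ → EfficientBSM L₂ →
                 (L : Lang) → InNP L → EfficientIH2 L
corollary2p9 L₁ L₂ L₁-hard sh bsm L L∈NP = instanceHiding (L₁-hard L L∈NP) sh bsm
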